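{- For nonnegative integers $m,n$ let $H_{m,n}(u)=\sum_{k=0}^{\min(m,n)}\binom mk\binom nk k!\,u^k$. Then, as formal power series in $v,w,x,y,z$, \begin{multline*} \sum_{i,j,k,l,m\ge0}H_{i+2k+m,\,j+2l+m}(u)\frac{v^i}{i!}\frac{w^j}{j!}\frac{x^k}{k!}\frac{y^l}{l!}\frac{z^m}{m!} =\frac{1}{\sqrt{(1-uz)^2-4u^2xy}}\\ \times\exp\!\left(\frac{(1+uw)^2x+(1+uv)^2y+4uxy+(1-uz)(v+w+z+uvw)}{(1-uz)^2-4u^2xy}\right). \end{multline*} -}

module Defs where

open import Data.Nat as ℕ using (ℕ; zero; suc; _∸_; _!; _⊓_; _≤ᵇ_)
open import Data.Nat.Properties using (_!≢0)
open import Data.Nat.Combinatorics using (_C_)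
open import Data.Integer using (+_)
open import Data.Rational as ℚ using (ℚ; 0ℚ; 1ℚ; _+_; _*_; -_; _/_)
open import Data.List using (List; []; _∷_; [_]; map; concatMap; upTo; foldr)
open import Data.Vec using (Vec; []; _∷_; lookup; toList; replicate; updateAt)
open import Data.Fin using (Fin)
open import Data.Bool using (if_then_else_)
open import Data.Product using (_×_; _,_)

-- Formal power series over ℚ in six commuting variables u v w x y z,
-- represented by their coefficient function on exponent vectors
-- (e_u , e_v , e_w , e_x , e_y , e_z).

Mono : Set
Mono = Vec ℕ 6

Series : Set
Series = Mono → ℚ

sumL : {A : Set} → (A → ℚ) → List A → ℚ
sumL f = foldr (λ a s → f a + s) 0ℚ

sumTo : ℕ → (ℕ → ℚ) → ℚ
sumTo N f = sumL f (upTo (suc N))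

splits : ∀ {n} → Vec ℕ n → List (Vec ℕ n × Vec ℕ n)
splits [] = [ ([] , []) ]
splits (a ∷ as) =
  concatMap (λ i → map (λ { (b , c) → (i ∷ b , (a ∸ i) ∷ c) }) (splits as))
            (upTo (suc a))

deg : Mono → ℕ
deg a = foldr ℕ._+_ 0 (toList a)

_⊕_ : Series → Series → Series
(f ⊕ g) a = f a + g a

_⊗_ : Series → Series → Series
(f ⊗ g) a = sumL (λ { (b , c) → f b * g c }) (splits a)

infixl 6 _⊕_
infixl 7 _⊗_

const : ℚ → Series
const q a = if deg a ℕ.≤ᵇ 0 then q else 0ℚ

nat : ℕ → Series
nat n = const (+ n / 1)

neg : Series → Series
neg f a = - f a

_⊖_ : Series → Series → Series
f ⊖ g = f ⊕ neg g

infixl 6 _⊖_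

var : Fin 6 → Series
var i = λ a → if eqMono a then 1ℚ else 0ℚ
  where
  target : Mono
  target = updateAt (replicate 6 0) i (λ _ → 1)
  eqV : ∀ {n} → Vec ℕ n → Vec ℕ n → Data.Bool.Bool
  eqV [] [] = Data.Bool.true
  eqV (x ∷ xs) (y ∷ ys) = (x ℕ.≡ᵇ y) Data.Bool.∧ eqV xs ys
  eqMono : Mono → Data.Bool.Bool
  eqMono a = eqV a target

U V W X Y Z : Series
U = var Fin.zero
V = var (Fin.suc Fin.zero)
W = var (Fin.suc (Fin.suc Fin.zero))
X = var (Fin.suc (Fin.suc (Fin.suc Fin.zero)))
Y = var (Fin.suc (Fin.suc (Fin.suc (Fin.suc Fin.zero))))
Z = var (Fin.suc (Fin.suc (Fin.suc (Fin.suc (Fin.suc Fin.zero)))))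

one : Series
one = nat 1

pow : Series → ℕ → Series
pow f zero = one
pow f (suc n) = f ⊗ pow f n

-- exp f := Σ_n f^n / n!, for f with zero constant term.  Then f^n has
-- no monomials of total degree < n, so the coefficient of a only gets
-- contributions from n ≤ deg a and the sum below is exact.
expS : Series → Series
expS f a = sumTo (deg a) (λ n → ((+ 1) / (n !)) {{n !≢0}} * pow f n a)

-- For g with constant term 1, write g = 1 - t (t with zero constant term).
-- 1/g = Σ_n t^n.
recipS : Series → Series
recipS g a = sumTo (deg a) (λ n → pow (one ⊖ g) n a)

-- 1/√g = (1 - t)^{-1/2} = Σ_n binom(2n,n)/4^n t^n  (the unique square
-- root of 1/g with constant term 1).
invSqrtS : Series → Series
invSqrtS g a =
  sumTo (deg a)
    (λ n → ((+ ((2 ℕ.* n) C n)) / (4 ℕ.^ n)) {{nz n}} * pow (one ⊖ g) n a)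
  where
  open import Data.Nat.Properties using (m^n≢0)
  nz : (n : ℕ) → ℕ.NonZero (4 ℕ.^ n)
  nz n = m^n≢0 4 n

-- H_{m,n}(u) = Σ_{k=0}^{min(m,n)} C(m,k) C(n,k) k! u^k,
-- given as its coefficient of u^p.
Hcoeff : ℕ → ℕ → ℕ → ℚ
Hcoeff m n p =
  if p ℕ.≤ᵇ (m ⊓ n) then (+ ((m C p) ℕ.* (n C p) ℕ.* (p !))) / 1 else 0ℚ

LHS : Series
LHS (p ∷ i ∷ j ∷ k ∷ l ∷ m ∷ []) =
  Hcoeff (i ℕ.+ 2 ℕ.* k ℕ.+ m) (j ℕ.+ 2 ℕ.* l ℕ.+ m) p
  * (((+ 1) / (i ! ℕ.* j ! ℕ.* k ! ℕ.* l ! ℕ.* m !))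
       {{Data.Nat.Properties.m*n≢0 _ _
          {{Data.Nat.Properties.m*n≢0 _ _
            {{Data.Nat.Properties.m*n≢0 _ _ {{Data.Nat.Properties.m*n≢0 _ _ {{i !≢0}} {{j !≢0}}}} {{k !≢0}}}}
            {{l !≢0}}}}
          {{m !≢0}}}})

Den : Series
Den = pow (one ⊖ U ⊗ Z) 2 ⊖ nat 4 ⊗ pow U 2 ⊗ X ⊗ Y

Num : Series
Num = pow (one ⊕ U ⊗ W) 2 ⊗ X
    ⊕ pow (one ⊕ U ⊗ V) 2 ⊗ Y
    ⊕ nat 4 ⊗ U ⊗ X ⊗ Y
    ⊕ (one ⊖ U ⊗ Z) ⊗ (V ⊕ W ⊕ Z ⊕ U ⊗ V ⊗ W)

RHS : Series
RHS = invSqrtS Den ⊗ expS (Num ⊗ recipS Den)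

{-# OPTIONS --safe #-}
-- Write F(p,i,j,k,l,m) for the coefficient of u^p v^i w^j x^k y^l z^m. With D = (1 - uz)² - 4u²xy and
-- N the numerator of the exponent, the right-hand side R = D^(-1/2) exp(N/D) satisfies the Euler
-- equations 2D² θ_j R = R P_j, where θ_j = x_j ∂/∂x_j and P_j = 2 (θ_j N · D - N · θ_j D) - θ_j D · D.
-- Eliminating between these polynomially and cancelling 2D² gives
--   θ_v R = v (R + u (θ_w + 2 θ_y + θ_z - θ_u) R),   v² θ_x R = x (θ_v² - θ_v) R,   v w θ_z R = z θ_v θ_w R
-- and their v ↔ w, x ↔ y mirrors, that is, recurrences raising each of i, …, m by one; moreover
-- R(u^p) = [p = 0]. The left-hand side satisfies the same recurrences by Pascal's rule and the
-- absorption identity for binomial coefficients, and the recurrences determine F by induction on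
-- i + j + 3 (k + l + m).
module Submission where

open import Defs
open import Level using (0ℓ)
open import Function using (_∘_; id)
open import Data.Bool using (Bool; true; false; if_then_else_; _∧_; T)
open import Data.Empty using (⊥-elim)
open import Data.Maybe using (nothing)
open import Data.Product using (Σ; _×_; _,_; proj₁; proj₂)
open import Data.Nat as ℕ using (ℕ; zero; suc; _∸_; _≤_; _<_; z≤n; s≤s; _≤ᵇ_; _!)
import Data.Nat.Properties as ℕP
open import Data.Nat.Combinatorics using (_C_; nCk+nC[k+1]≡[n+1]C[k+1]; nCk≡nC[n∸k]; nC1≡n)
open import Data.Nat.Combinatorics.Specification using (k>n⇒nCk≡0)
open import Data.Nat.Induction using (<-rec)
import Data.Nat.Solver
open import Data.Integer as ℤ using (ℤ)
import Data.Integer.Properties as ℤP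
open import Data.Rational as ℚ using (ℚ; 0ℚ; 1ℚ; _+_; _*_; -_; _-_; _/_)
import Data.Rational.Properties as ℚP
import Data.Rational.Unnormalised as ℚᵘ
import Data.Rational.Unnormalised.Properties as ℚᵘP
import Data.Rational.Solver
open import Data.List using (List; []; _∷_; foldr; map; concatMap; upTo; _++_; applyUpTo)
open import Data.Vec using (Vec; []; _∷_; lookup; toList; replicate; updateAt; zipWith) renaming (_++_ to _++ᵛ_)
import Data.Vec.Properties as VecP
open import Data.Fin as Fin using (Fin; #_)
open import Relation.Nullary using (Dec; does; yes; no)
open import Relation.Binary.PropositionalEquality
open import Relation.Binary.Bundles using (Setoid)
open import Relation.Binary.Structures using (IsEquivalence)
import Relation.Binary.Reasoning.Setoid as SetoidReasoning
open import Algebra.Bundles using (CommutativeMonoid)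
import Algebra.Structures as AS
open import Algebra.Structures.Biased using (isCommutativeMonoidˡ; isCommutativeSemiringˡ)
open import Algebra.Properties.CommutativeSemigroup
  (CommutativeMonoid.commutativeSemigroup ℚP.*-1-commutativeMonoid)
  using (x∙yz≈y∙xz)
import Algebra.Properties.CommutativeSemigroup
  (CommutativeMonoid.commutativeSemigroup ℚP.+-0-commutativeMonoid) as +-Props
open import Tactic.RingSolver.Core.AlmostCommutativeRing using (AlmostCommutativeRing)
open import Tactic.RingSolver.Core.Polynomial.Parameters using (Homomorphism)

module ℕS = Data.Nat.Solver.+-*-Solver
module ℚS = Data.Rational.Solver.+-*-Solver

ιℤ : ℤ → ℚ
ιℤ z = z / 1

ι : ℕ → ℚ
ι n = ℤ.+ n / 1

private
  toℚᵘ-ιℤ : ∀ z → ℚ.toℚᵘ (ιℤ z) ℚᵘ.≃ ℚᵘ.mkℚᵘ z 0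
  toℚᵘ-ιℤ z = ℚP.toℚᵘ-fromℚᵘ (ℚᵘ.mkℚᵘ z 0)

  infixr 3 _⟫_
  _⟫_ : ∀ {x y z} → x ℚᵘ.≃ y → y ℚᵘ.≃ z → x ℚᵘ.≃ z
  _⟫_ = ℚᵘP.≃-trans

ιℤ-+ : ∀ x y → ιℤ (x ℤ.+ y) ≡ ιℤ x + ιℤ y
ιℤ-+ x y = ℚP.toℚᵘ-injective
  (toℚᵘ-ιℤ (x ℤ.+ y) ⟫ ℚᵘ.*≡* eq ⟫ ℚᵘP.+-cong (ℚᵘP.≃-sym (toℚᵘ-ιℤ x)) (ℚᵘP.≃-sym (toℚᵘ-ιℤ y))
                     ⟫ ℚᵘP.≃-sym (ℚP.toℚᵘ-homo-+ (ιℤ x) (ιℤ y)))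
  where
  eq : (x ℤ.+ y) ℤ.* ℤ.+ 1 ≡ (x ℤ.* ℤ.+ 1 ℤ.+ y ℤ.* ℤ.+ 1) ℤ.* ℤ.+ 1
  eq = trans (ℤP.*-identityʳ _)
         (sym (trans (ℤP.*-identityʳ _) (cong₂ ℤ._+_ (ℤP.*-identityʳ x) (ℤP.*-identityʳ y))))

ιℤ-* : ∀ x y → ιℤ (x ℤ.* y) ≡ ιℤ x * ιℤ y
ιℤ-* x y = ℚP.toℚᵘ-injective
  (toℚᵘ-ιℤ (x ℤ.* y) ⟫ ℚᵘ.*≡* refl ⟫ ℚᵘP.*-cong (ℚᵘP.≃-sym (toℚᵘ-ιℤ x)) (ℚᵘP.≃-sym (toℚᵘ-ιℤ y))
                     ⟫ ℚᵘP.≃-sym (ℚP.toℚᵘ-homo-* (ιℤ x) (ιℤ y)))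

ιℤ-neg : ∀ x → ιℤ (ℤ.- x) ≡ - ιℤ x
ιℤ-neg x = ℚP.toℚᵘ-injective
  (toℚᵘ-ιℤ (ℤ.- x) ⟫ ℚᵘP.-‿cong (ℚᵘP.≃-sym (toℚᵘ-ιℤ x)) ⟫ ℚᵘP.≃-sym (ℚP.toℚᵘ-homo‿- (ιℤ x)))

ι-+ : ∀ m n → ι (m ℕ.+ n) ≡ ι m + ι n
ι-+ m n = ιℤ-+ (ℤ.+ m) (ℤ.+ n)

ι-* : ∀ m n → ι (m ℕ.* n) ≡ ι m * ι n
ι-* m n = trans (cong ιℤ (ℤP.pos-* m n)) (ιℤ-* (ℤ.+ m) (ℤ.+ n))

ι-suc : ∀ n → ι (suc n) ≡ 1ℚ + ι n
ι-suc = ι-+ 1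

[z/d]*d≡z : ∀ z d .{{_ : ℕ.NonZero d}} → (z / d) * ι d ≡ ιℤ z
[z/d]*d≡z z (suc d) = ℚP.toℚᵘ-injective
  (ℚP.toℚᵘ-homo-* (z / suc d) (ι (suc d)) ⟫ ℚᵘP.*-cong (ℚP.toℚᵘ-fromℚᵘ (ℚᵘ.mkℚᵘ z d)) (toℚᵘ-ιℤ (ℤ.+ suc d))
                                          ⟫ ℚᵘ.*≡* eq ⟫ ℚᵘP.≃-sym (toℚᵘ-ιℤ z))
  where
  eq : (z ℤ.* ℤ.+ suc d) ℤ.* ℤ.+ 1 ≡ z ℤ.* (ℤ.+ (suc d ℕ.* 1))
  eq = trans (ℤP.*-identityʳ _) (cong (z ℤ.*_) (cong ℤ.+_ (sym (ℕP.*-identityʳ (suc d)))))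

ι*-cancelˡ : ∀ d .{{_ : ℕ.NonZero d}} {x y} → ι d * x ≡ ι d * y → x ≡ y
ι*-cancelˡ d {x} {y} eq = begin
  x                                ≡⟨ sym (ℚP.*-identityˡ x) ⟩
  1ℚ * x                           ≡⟨ cong (_* x) (sym ([z/d]*d≡z (ℤ.+ 1) d)) ⟩
  ((ℤ.+ 1 / d) * ι d) * x          ≡⟨ ℚP.*-assoc (ℤ.+ 1 / d) (ι d) x ⟩
  (ℤ.+ 1 / d) * (ι d * x)          ≡⟨ cong ((ℤ.+ 1 / d) *_) eq ⟩
  (ℤ.+ 1 / d) * (ι d * y)          ≡⟨ sym (ℚP.*-assoc (ℤ.+ 1 / d) (ι d) y) ⟩
  ((ℤ.+ 1 / d) * ι d) * y          ≡⟨ cong (_* y) ([z/d]*d≡z (ℤ.+ 1) d) ⟩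
  1ℚ * y                           ≡⟨ ℚP.*-identityˡ y ⟩
  y                                ∎
  where open ≡-Reasoning

x*d≡z⇒x≡z/d : ∀ x z d .{{_ : ℕ.NonZero d}} → x * ι d ≡ ιℤ z → x ≡ z / d
x*d≡z⇒x≡z/d x z d h =
  ι*-cancelˡ d (trans (ℚP.*-comm (ι d) x) (trans h (trans (sym ([z/d]*d≡z z d)) (ℚP.*-comm (z / d) (ι d)))))

n*[1/d′]≡1/d : ∀ n d d′ .{{_ : ℕ.NonZero d}} .{{_ : ℕ.NonZero d′}} →
  d′ ≡ n ℕ.* d → ι n * (ℤ.+ 1 / d′) ≡ ℤ.+ 1 / d
n*[1/d′]≡1/d n d d′ d′≡nd = x*d≡z⇒x≡z/d _ (ℤ.+ 1) d (begin
  (ι n * (ℤ.+ 1 / d′)) * ι d   ≡⟨ ℚP.*-assoc (ι n) _ (ι d) ⟩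
  ι n * ((ℤ.+ 1 / d′) * ι d)   ≡⟨ x∙yz≈y∙xz (ι n) (ℤ.+ 1 / d′) (ι d) ⟩
  (ℤ.+ 1 / d′) * (ι n * ι d)   ≡⟨ cong ((ℤ.+ 1 / d′) *_) (sym (ι-* n d)) ⟩
  (ℤ.+ 1 / d′) * ι (n ℕ.* d)   ≡⟨ cong (λ t → (ℤ.+ 1 / d′) * ι t) (sym d′≡nd) ⟩
  (ℤ.+ 1 / d′) * ι d′          ≡⟨ [z/d]*d≡z (ℤ.+ 1) d′ ⟩
  1ℚ                           ∎)
  where open ≡-Reasoning

Σ< : ℕ → (ℕ → ℚ) → ℚ
Σ< zero    f = 0ℚ
Σ< (suc n) f = f 0 + Σ< n (f ∘ suc)

sumL-applyUpTo : ∀ {A : Set} (f : A → ℚ) (g : ℕ → A) n → sumL f (applyUpTo g n) ≡ Σ< n (f ∘ g)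
sumL-applyUpTo f g zero    = refl
sumL-applyUpTo f g (suc n) = cong (f (g 0) +_) (sumL-applyUpTo f (g ∘ suc) n)

sumTo≡Σ< : ∀ N f → sumTo N f ≡ Σ< (suc N) f
sumTo≡Σ< N f = sumL-applyUpTo f id (suc N)

Σ<-cong : ∀ n {f g} → (∀ i → i < n → f i ≡ g i) → Σ< n f ≡ Σ< n g
Σ<-cong zero    h = refl
Σ<-cong (suc n) h = cong₂ _+_ (h 0 (s≤s z≤n)) (Σ<-cong n (λ i i<n → h (suc i) (s≤s i<n)))

Σ<-congf : ∀ n {f g} → (∀ i → f i ≡ g i) → Σ< n f ≡ Σ< n g
Σ<-congf n h = Σ<-cong n (λ i _ → h i)

Σ<-+ : ∀ n f g → Σ< n (λ i → f i + g i) ≡ Σ< n f + Σ< n g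
Σ<-+ zero    f g = refl
Σ<-+ (suc n) f g =
  trans (cong (f 0 + g 0 +_) (Σ<-+ n (f ∘ suc) (g ∘ suc))) (+-Props.interchange (f 0) (g 0) _ _)

Σ<-*ˡ : ∀ n c f → Σ< n (λ i → c * f i) ≡ c * Σ< n f
Σ<-*ˡ zero    c f = sym (ℚP.*-zeroʳ c)
Σ<-*ˡ (suc n) c f = trans (cong (c * f 0 +_) (Σ<-*ˡ n c (f ∘ suc))) (sym (ℚP.*-distribˡ-+ c (f 0) _))

Σ<-neg : ∀ n f → Σ< n (λ i → - f i) ≡ - Σ< n f
Σ<-neg zero    f = refl
Σ<-neg (suc n) f = trans (cong (- f 0 +_) (Σ<-neg n (f ∘ suc))) (sym (ℚP.neg-distrib-+ (f 0) _))

Σ<-0 : ∀ n → Σ< n (λ _ → 0ℚ) ≡ 0ℚ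
Σ<-0 zero    = refl
Σ<-0 (suc n) = trans (ℚP.+-identityˡ _) (Σ<-0 n)

Σ<-zero : ∀ n f → (∀ i → f i ≡ 0ℚ) → Σ< n f ≡ 0ℚ
Σ<-zero n f h = trans (Σ<-congf n h) (Σ<-0 n)

Σ<-last : ∀ n f → Σ< (suc n) f ≡ Σ< n f + f n
Σ<-last zero    f = trans (ℚP.+-identityʳ (f 0)) (sym (ℚP.+-identityˡ (f 0)))
Σ<-last (suc n) f = trans (cong (f 0 +_) (Σ<-last n (f ∘ suc))) (sym (ℚP.+-assoc (f 0) _ _))

Σ<-last-zero : ∀ n f → f n ≡ 0ℚ → Σ< (suc n) f ≡ Σ< n f
Σ<-last-zero n f fn≡0 = trans (Σ<-last n f) (trans (cong (Σ< n f +_) fn≡0) (ℚP.+-identityʳ (Σ< n f)))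

Σ<-split : ∀ m d f → Σ< (m ℕ.+ d) f ≡ Σ< m f + Σ< d (λ k → f (m ℕ.+ k))
Σ<-split zero    d f = sym (ℚP.+-identityˡ (Σ< d f))
Σ<-split (suc m) d f = trans (cong (f 0 +_) (Σ<-split m d (f ∘ suc))) (sym (ℚP.+-assoc (f 0) _ _))

Σ<-reverse : ∀ a (G : ℕ → ℕ → ℚ) →
  Σ< (suc a) (λ i → G i (a ∸ i)) ≡ Σ< (suc a) (λ i → G (a ∸ i) i)
Σ<-reverse zero    G = refl
Σ<-reverse (suc a) G = begin
  G 0 (suc a) + Σ< (suc a) (λ i → G (suc i) (a ∸ i))
    ≡⟨ cong (G 0 (suc a) +_) (Σ<-reverse a (G ∘ suc)) ⟩
  G 0 (suc a) + Σ< (suc a) (λ i → G (suc (a ∸ i)) i)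
    ≡⟨ ℚP.+-comm (G 0 (suc a)) _ ⟩
  Σ< (suc a) (λ i → G (suc (a ∸ i)) i) + G 0 (suc a)
    ≡⟨ cong₂ _+_ (Σ<-cong (suc a) (λ i i≤a → cong (λ t → G t i) (sym (ℕP.+-∸-assoc 1 (ℕP.≤-pred i≤a)))))
                 (cong (λ t → G t (suc a)) (sym (ℕP.n∸n≡0 a))) ⟩
  Σ< (suc a) (λ i → G (suc a ∸ i) i) + G (suc a ∸ suc a) (suc a)
    ≡⟨ sym (Σ<-last (suc a) (λ i → G (suc a ∸ i) i)) ⟩
  Σ< (suc (suc a)) (λ i → G (suc a ∸ i) i) ∎
  where open ≡-Reasoning

Σ<-triangle : ∀ a (φ : ℕ → ℕ → ℕ → ℚ) →
  Σ< (suc a) (λ i → Σ< (suc i) (λ j → φ j (i ∸ j) (a ∸ i))) ≡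
  Σ< (suc a) (λ j → Σ< (suc (a ∸ j)) (λ k → φ j k (a ∸ j ∸ k)))
Σ<-triangle zero    φ = refl
Σ<-triangle (suc a) φ = begin
  (φ 0 0 (suc a) + 0ℚ) + Σ< (suc a) (λ i → φ 0 (suc i) (a ∸ i) + rows i)
    ≡⟨ cong₂ _+_ (ℚP.+-identityʳ (φ 0 0 (suc a))) (Σ<-+ (suc a) (λ i → φ 0 (suc i) (a ∸ i)) rows) ⟩
  φ 0 0 (suc a) + (first + Σ< (suc a) rows)       ≡⟨ cong (λ t → φ 0 0 (suc a) + (first + t)) (Σ<-triangle a (φ ∘ suc)) ⟩
  φ 0 0 (suc a) + (first + Σ< (suc a) columns)    ≡⟨ sym (ℚP.+-assoc (φ 0 0 (suc a)) first _) ⟩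
  (φ 0 0 (suc a) + first) + Σ< (suc a) columns    ∎
  where
  open ≡-Reasoning
  first : ℚ
  first = Σ< (suc a) (λ i → φ 0 (suc i) (a ∸ i))
  rows columns : ℕ → ℚ
  rows i    = Σ< (suc i) (λ j → φ (suc j) (i ∸ j) (a ∸ i))
  columns j = Σ< (suc (a ∸ j)) (λ k → φ (suc j) k (a ∸ j ∸ k))

Σ<-indicator : ∀ a t (F : ℕ → ℚ) →
  Σ< (suc a) (λ i → if i ℕ.≡ᵇ t then F i else 0ℚ) ≡ (if t ≤ᵇ a then F t else 0ℚ)
Σ<-indicator zero    zero    F = ℚP.+-identityʳ _
Σ<-indicator zero    (suc t) F = refl
Σ<-indicator (suc a) zero    F = trans (cong (F 0 +_) (Σ<-0 (suc a))) (ℚP.+-identityʳ _)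
Σ<-indicator (suc a) (suc t) F = trans (ℚP.+-identityˡ _)
  (trans (Σ<-indicator a t (F ∘ suc)) (cong (λ β → if β then F (suc t) else 0ℚ) (sym (≤ᵇ-suc t a))))
  where
  ≤ᵇ-suc : ∀ t a → (suc t ≤ᵇ suc a) ≡ (t ≤ᵇ a)
  ≤ᵇ-suc zero    a = refl
  ≤ᵇ-suc (suc t) a = refl

sumL-cong : ∀ {A : Set} {f g : A → ℚ} xs → (∀ x → f x ≡ g x) → sumL f xs ≡ sumL g xs
sumL-cong []       h = refl
sumL-cong (x ∷ xs) h = cong₂ _+_ (h x) (sumL-cong xs h)

sumL-+ : ∀ {A : Set} (f g : A → ℚ) xs → sumL (λ x → f x + g x) xs ≡ sumL f xs + sumL g xs
sumL-+ f g []       = refl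
sumL-+ f g (x ∷ xs) = trans (cong (f x + g x +_) (sumL-+ f g xs)) (+-Props.interchange (f x) (g x) _ _)

sumL-*ˡ : ∀ {A : Set} c (f : A → ℚ) xs → sumL (λ x → c * f x) xs ≡ c * sumL f xs
sumL-*ˡ c f []       = sym (ℚP.*-zeroʳ c)
sumL-*ˡ c f (x ∷ xs) = trans (cong (c * f x +_) (sumL-*ˡ c f xs)) (sym (ℚP.*-distribˡ-+ c _ _))

sumL-neg : ∀ {A : Set} (f : A → ℚ) xs → sumL (λ x → - f x) xs ≡ - sumL f xs
sumL-neg f []       = refl
sumL-neg f (x ∷ xs) = trans (cong (- f x +_) (sumL-neg f xs)) (sym (ℚP.neg-distrib-+ (f x) _))

sumL-0 : ∀ {A : Set} (xs : List A) → sumL (λ _ → 0ℚ) xs ≡ 0ℚ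
sumL-0 []       = refl
sumL-0 (x ∷ xs) = trans (ℚP.+-identityˡ _) (sumL-0 xs)

sumL-++ : ∀ {A : Set} (f : A → ℚ) xs ys → sumL f (xs ++ ys) ≡ sumL f xs + sumL f ys
sumL-++ f []       ys = sym (ℚP.+-identityˡ (sumL f ys))
sumL-++ f (x ∷ xs) ys = trans (cong (f x +_) (sumL-++ f xs ys)) (sym (ℚP.+-assoc (f x) _ _))

sumL-map : ∀ {A B : Set} (f : B → ℚ) (h : A → B) xs → sumL f (map h xs) ≡ sumL (f ∘ h) xs
sumL-map f h []       = refl
sumL-map f h (x ∷ xs) = cong (f (h x) +_) (sumL-map f h xs)

sumL-concatMap : ∀ {A B : Set} (f : B → ℚ) (g : A → List B) xs →
  sumL f (concatMap g xs) ≡ sumL (λ x → sumL f (g x)) xs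
sumL-concatMap f g []       = refl
sumL-concatMap f g (x ∷ xs) =
  trans (sumL-++ f (g x) (concatMap g xs)) (cong (sumL f (g x) +_) (sumL-concatMap f g xs))

sumL-Σ<-comm : ∀ {A : Set} n (f : A → ℕ → ℚ) xs →
  sumL (λ x → Σ< n (f x)) xs ≡ Σ< n (λ i → sumL (λ x → f x i) xs)
sumL-Σ<-comm n f []       = sym (Σ<-0 n)
sumL-Σ<-comm n f (x ∷ xs) = trans (cong (Σ< n (f x) +_) (sumL-Σ<-comm n f xs)) (sym (Σ<-+ n (f x) _))

Summand : ℕ → Set
Summand n = Vec ℕ n → Vec ℕ n → ℚ

conv : ∀ {n} → Summand n → Vec ℕ n → ℚ
conv Φ a = sumL (λ p → Φ (proj₁ p) (proj₂ p)) (splits a)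

_⊞_ : ∀ {n} → Vec ℕ n → Vec ℕ n → Vec ℕ n
_⊞_ = zipWith ℕ._+_

degV : ∀ {n} → Vec ℕ n → ℕ
degV a = foldr ℕ._+_ 0 (toList a)

conv-cons : ∀ {n} (Φ : Vec ℕ (suc n) → Vec ℕ (suc n) → ℚ) a as →
  conv Φ (a ∷ as) ≡ Σ< (suc a) (λ i → conv (λ b c → Φ (i ∷ b) ((a ∸ i) ∷ c)) as)
conv-cons {n} Φ a as = begin
  sumL Φ′ (concatMap (λ i → map (cons i) (splits as)) (upTo (suc a)))
    ≡⟨ sumL-concatMap Φ′ (λ i → map (cons i) (splits as)) (upTo (suc a)) ⟩
  sumL (λ i → sumL Φ′ (map (cons i) (splits as))) (upTo (suc a))
    ≡⟨ sumL-cong (upTo (suc a)) (λ i → sumL-map Φ′ (cons i) (splits as)) ⟩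
  sumL (λ i → conv (λ b c → Φ (i ∷ b) ((a ∸ i) ∷ c)) as) (upTo (suc a))
    ≡⟨ sumL-applyUpTo (λ i → conv (λ b c → Φ (i ∷ b) ((a ∸ i) ∷ c)) as) id (suc a) ⟩
  Σ< (suc a) (λ i → conv (λ b c → Φ (i ∷ b) ((a ∸ i) ∷ c)) as) ∎
  where
  open ≡-Reasoning
  Φ′ : Vec ℕ (suc n) × Vec ℕ (suc n) → ℚ
  Φ′ p = Φ (proj₁ p) (proj₂ p)
  cons : ℕ → Vec ℕ n × Vec ℕ n → Vec ℕ (suc n) × Vec ℕ (suc n)
  cons i p = (i ∷ proj₁ p , (a ∸ i) ∷ proj₂ p)

conv-cong : ∀ {n} {Φ Ψ : Summand n} a → (∀ b c → Φ b c ≡ Ψ b c) → conv Φ a ≡ conv Ψ a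
conv-cong a h = sumL-cong (splits a) (λ p → h (proj₁ p) (proj₂ p))

conv-+ : ∀ {n} (Φ Ψ : Summand n) a → conv (λ b c → Φ b c + Ψ b c) a ≡ conv Φ a + conv Ψ a
conv-+ Φ Ψ a = sumL-+ (λ p → Φ (proj₁ p) (proj₂ p)) (λ p → Ψ (proj₁ p) (proj₂ p)) (splits a)

conv-*ˡ : ∀ {n} q (Φ : Summand n) a → conv (λ b c → q * Φ b c) a ≡ q * conv Φ a
conv-*ˡ q Φ a = sumL-*ˡ q (λ p → Φ (proj₁ p) (proj₂ p)) (splits a)

conv-*ʳ : ∀ {n} (Φ : Summand n) q a → conv Φ a * q ≡ conv (λ b c → Φ b c * q) a
conv-*ʳ Φ q a = trans (ℚP.*-comm (conv Φ a) q)
  (trans (sym (conv-*ˡ q Φ a)) (conv-cong a (λ b c → ℚP.*-comm q (Φ b c))))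

conv-neg : ∀ {n} (Φ : Summand n) a → conv (λ b c → - Φ b c) a ≡ - conv Φ a
conv-neg Φ a = sumL-neg (λ p → Φ (proj₁ p) (proj₂ p)) (splits a)

conv-Σ<-comm : ∀ {n} m (Φ : ℕ → Summand n) a →
  conv (λ b c → Σ< m (λ i → Φ i b c)) a ≡ Σ< m (λ i → conv (Φ i) a)
conv-Σ<-comm m Φ a = sumL-Σ<-comm m (λ p i → Φ i (proj₁ p) (proj₂ p)) (splits a)

conv-ext : ∀ {n} {Φ Ψ : Summand n} (a : Vec ℕ n) →
  (∀ b c → b ⊞ c ≡ a → Φ b c ≡ Ψ b c) → conv Φ a ≡ conv Ψ a
conv-ext []       h = cong (_+ 0ℚ) (h [] [] refl)
conv-ext {Φ = Φ} {Ψ} (a ∷ as) h = begin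
  conv Φ (a ∷ as)                                              ≡⟨ conv-cons Φ a as ⟩
  Σ< (suc a) (λ i → conv (λ b c → Φ (i ∷ b) ((a ∸ i) ∷ c)) as)
    ≡⟨ Σ<-cong (suc a) (λ i i≤a → conv-ext as (λ b c b⊞c≡as →
         h (i ∷ b) ((a ∸ i) ∷ c) (cong₂ _∷_ (ℕP.m+[n∸m]≡n (ℕP.≤-pred i≤a)) b⊞c≡as))) ⟩
  Σ< (suc a) (λ i → conv (λ b c → Ψ (i ∷ b) ((a ∸ i) ∷ c)) as) ≡⟨ sym (conv-cons Ψ a as) ⟩
  conv Ψ (a ∷ as)                                              ∎
  where open ≡-Reasoning

conv-zero : ∀ {n} (Φ : Summand n) a → (∀ b c → b ⊞ c ≡ a → Φ b c ≡ 0ℚ) → conv Φ a ≡ 0ℚ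
conv-zero Φ a h = trans (conv-ext a h) (sumL-0 (splits a))

conv-comm : ∀ {n} (Φ : Summand n) a → conv Φ a ≡ conv (λ b c → Φ c b) a
conv-comm Φ []       = refl
conv-comm Φ (a ∷ as) = begin
  conv Φ (a ∷ as)                                                ≡⟨ conv-cons Φ a as ⟩
  Σ< (suc a) (λ i → conv (λ b c → Φ (i ∷ b) ((a ∸ i) ∷ c)) as)
    ≡⟨ Σ<-congf (suc a) (λ i → conv-comm (λ b c → Φ (i ∷ b) ((a ∸ i) ∷ c)) as) ⟩
  Σ< (suc a) (λ i → conv (λ b c → Φ (i ∷ c) ((a ∸ i) ∷ b)) as)
    ≡⟨ Σ<-reverse a (λ i k → conv (λ b c → Φ (i ∷ c) (k ∷ b)) as) ⟩
  Σ< (suc a) (λ i → conv (λ b c → Φ ((a ∸ i) ∷ c) (i ∷ b)) as)   ≡⟨ sym (conv-cons (λ b c → Φ c b) a as) ⟩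
  conv (λ b c → Φ c b) (a ∷ as)                                  ∎
  where open ≡-Reasoning

conv-assoc : ∀ {n} (Ψ : Vec ℕ n → Summand n) a →
  conv (λ x d → conv (λ b c → Ψ b c d) x) a ≡ conv (λ b y → conv (λ c d → Ψ b c d) y) a
conv-assoc Ψ []       = refl
conv-assoc Ψ (a ∷ as) = begin
  conv (λ x d → conv (λ b c → Ψ b c d) x) (a ∷ as)
    ≡⟨ conv-cons (λ x d → conv (λ b c → Ψ b c d) x) a as ⟩
  Σ< (suc a) (λ i → conv (λ x d → conv (λ b c → Ψ b c ((a ∸ i) ∷ d)) (i ∷ x)) as)
    ≡⟨ Σ<-congf (suc a) (λ i → trans
         (conv-cong as (λ x d → conv-cons (λ b c → Ψ b c ((a ∸ i) ∷ d)) i x))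
         (conv-Σ<-comm (suc i) (λ j x d → conv (λ b c → Ψ (j ∷ b) ((i ∸ j) ∷ c) ((a ∸ i) ∷ d)) x) as)) ⟩
  Σ< (suc a) (λ i → Σ< (suc i) (λ j → conv (λ x d → conv (λ b c → Ψ (j ∷ b) ((i ∸ j) ∷ c) ((a ∸ i) ∷ d)) x) as))
    ≡⟨ Σ<-congf (suc a) (λ i → Σ<-congf (suc i) (λ j →
         conv-assoc (λ b c d → Ψ (j ∷ b) ((i ∸ j) ∷ c) ((a ∸ i) ∷ d)) as)) ⟩
  Σ< (suc a) (λ i → Σ< (suc i) (λ j → φ j (i ∸ j) (a ∸ i)))
    ≡⟨ Σ<-triangle a φ ⟩
  Σ< (suc a) (λ j → Σ< (suc (a ∸ j)) (λ k → φ j k (a ∸ j ∸ k)))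
    ≡⟨ Σ<-congf (suc a) (λ j → trans
         (sym (conv-Σ<-comm (suc (a ∸ j)) (λ k b y → conv (λ c d → Ψ (j ∷ b) (k ∷ c) ((a ∸ j ∸ k) ∷ d)) y) as))
         (conv-cong as (λ b y → sym (conv-cons (λ c d → Ψ (j ∷ b) c d) (a ∸ j) y)))) ⟩
  Σ< (suc a) (λ j → conv (λ b y → conv (λ c d → Ψ (j ∷ b) c d) ((a ∸ j) ∷ y)) as)
    ≡⟨ sym (conv-cons (λ b y → conv (λ c d → Ψ b c d) y) a as) ⟩
  conv (λ b y → conv (λ c d → Ψ b c d) y) (a ∷ as) ∎
  where
  open ≡-Reasoning
  φ : ℕ → ℕ → ℕ → ℚ
  φ j k l = conv (λ b y → conv (λ c d → Ψ (j ∷ b) (k ∷ c) (l ∷ d)) y) as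

conv-unitˡ : ∀ {n} q (Φ : Summand n) a →
  conv (λ b c → (if degV b ≤ᵇ 0 then q else 0ℚ) * Φ b c) a ≡ q * Φ (replicate n 0) a
conv-unitˡ q Φ []       = ℚP.+-identityʳ _
conv-unitˡ q Φ (a ∷ as) = begin
  conv (λ b c → (if degV b ≤ᵇ 0 then q else 0ℚ) * Φ b c) (a ∷ as)
    ≡⟨ conv-cons (λ b c → (if degV b ≤ᵇ 0 then q else 0ℚ) * Φ b c) a as ⟩
  conv (λ b c → (if degV b ≤ᵇ 0 then q else 0ℚ) * Φ (0 ∷ b) (a ∷ c)) as
    + Σ< a (λ k → conv (λ b c → 0ℚ * Φ (suc k ∷ b) ((a ∸ suc k) ∷ c)) as)
    ≡⟨ cong₂ _+_ (conv-unitˡ q (λ b c → Φ (0 ∷ b) (a ∷ c)) as)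
                 (Σ<-zero a _ (λ k → conv-zero _ as (λ b c _ → ℚP.*-zeroˡ (Φ (suc k ∷ b) ((a ∸ suc k) ∷ c))))) ⟩
  q * Φ (0 ∷ replicate _ 0) (a ∷ as) + 0ℚ ≡⟨ ℚP.+-identityʳ _ ⟩
  q * Φ (0 ∷ replicate _ 0) (a ∷ as) ∎
  where open ≡-Reasoning

_≡ᵇᵛ_ : ∀ {n} → Vec ℕ n → Vec ℕ n → Bool
[]       ≡ᵇᵛ []       = true
(x ∷ xs) ≡ᵇᵛ (y ∷ ys) = (x ℕ.≡ᵇ y) ∧ (xs ≡ᵇᵛ ys)

≡ᵇᵛ⇒≡ : ∀ {n} (a t : Vec ℕ n) → T (a ≡ᵇᵛ t) → a ≡ t
≡ᵇᵛ⇒≡ []      []      _ = refl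
≡ᵇᵛ⇒≡ (x ∷ a) (y ∷ t) h with x ℕ.≡ᵇ y in x≡ᵇy
... | true = cong₂ _∷_ (ℕP.≡ᵇ⇒≡ x y (subst T (sym x≡ᵇy) _)) (≡ᵇᵛ⇒≡ a t h)

𝟙 : Bool → ℚ
𝟙 β = if β then 1ℚ else 0ℚ

offset : ∀ {n} → Vec ℕ n → Vec ℕ n → Summand n → ℚ
offset []       []       Φ = Φ [] []
offset (t ∷ ts) (a ∷ as) Φ = if t ≤ᵇ a then offset ts as (λ b c → Φ (t ∷ b) ((a ∸ t) ∷ c)) else 0ℚ

conv-𝟙 : ∀ {n} (t : Vec ℕ n) (Φ : Summand n) a →
  conv (λ b c → 𝟙 (b ≡ᵇᵛ t) * Φ b c) a ≡ offset t a Φ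
conv-𝟙 []       Φ []       = trans (ℚP.+-identityʳ _) (ℚP.*-identityˡ _)
conv-𝟙 (t ∷ ts) Φ (a ∷ as) = begin
  conv (λ b c → 𝟙 (b ≡ᵇᵛ (t ∷ ts)) * Φ b c) (a ∷ as)
    ≡⟨ conv-cons (λ b c → 𝟙 (b ≡ᵇᵛ (t ∷ ts)) * Φ b c) a as ⟩
  Σ< (suc a) (λ i → conv (λ b c → 𝟙 ((i ℕ.≡ᵇ t) ∧ (b ≡ᵇᵛ ts)) * Φ (i ∷ b) ((a ∸ i) ∷ c)) as)
    ≡⟨ Σ<-congf (suc a) (λ i → split (i ℕ.≡ᵇ t) i) ⟩
  Σ< (suc a) (λ i → if i ℕ.≡ᵇ t then Φ′ i else 0ℚ)   ≡⟨ Σ<-indicator a t Φ′ ⟩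
  (if t ≤ᵇ a then Φ′ t else 0ℚ)                      ≡⟨ cong (λ x → if t ≤ᵇ a then x else 0ℚ) (conv-𝟙 ts _ as) ⟩
  offset (t ∷ ts) (a ∷ as) Φ                         ∎
  where
  open ≡-Reasoning
  Φ′ : ℕ → ℚ
  Φ′ i = conv (λ b c → 𝟙 (b ≡ᵇᵛ ts) * Φ (i ∷ b) ((a ∸ i) ∷ c)) as
  split : ∀ β i →
    conv (λ b c → 𝟙 (β ∧ (b ≡ᵇᵛ ts)) * Φ (i ∷ b) ((a ∸ i) ∷ c)) as ≡ (if β then Φ′ i else 0ℚ)
  split true  i = refl
  split false i = conv-zero _ as (λ b c _ → ℚP.*-zeroˡ (Φ (i ∷ b) ((a ∸ i) ∷ c)))

lookup-⊞ : ∀ {n} {b c a : Vec ℕ n} (j : Fin n) → b ⊞ c ≡ a → lookup a j ≡ lookup b j ℕ.+ lookup c j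
lookup-⊞ {b = b} {c} j refl = VecP.lookup-zipWith ℕ._+_ j b c

degV-⊞ : ∀ {n} (b c : Vec ℕ n) → degV (b ⊞ c) ≡ degV b ℕ.+ degV c
degV-⊞ []      []      = refl
degV-⊞ (x ∷ b) (y ∷ c) = trans (cong ((x ℕ.+ y) ℕ.+_) (degV-⊞ b c)) (ℕS.solve 4
  (λ x y p q → (x ℕS.:+ y) ℕS.:+ (p ℕS.:+ q) ℕS.:= (x ℕS.:+ p) ℕS.:+ (y ℕS.:+ q)) refl x y (degV b) (degV c))

degV≡0⇒≡0 : ∀ {n} (b : Vec ℕ n) → degV b ≡ 0 → b ≡ replicate n 0
degV≡0⇒≡0 []      _ = refl
degV≡0⇒≡0 (x ∷ b) e = cong₂ _∷_ (ℕP.m+n≡0⇒m≡0 x e) (degV≡0⇒≡0 b (ℕP.m+n≡0⇒n≡0 x e))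

infix 4 _≈_
record _≈_ (f g : Series) : Set where
  constructor coeffwise
  field coeff : ∀ a → f a ≡ g a
open _≈_ public

≈-isEquivalence : IsEquivalence _≈_
≈-isEquivalence = record
  { refl  = coeffwise (λ _ → refl)
  ; sym   = λ p → coeffwise (λ a → sym (coeff p a))
  ; trans = λ p q → coeffwise (λ a → trans (coeff p a) (coeff q a))
  }

≈-setoid : Setoid 0ℓ 0ℓ
≈-setoid = record { isEquivalence = ≈-isEquivalence }

open IsEquivalence ≈-isEquivalence public
  using () renaming (refl to ≈-refl; sym to ≈-sym; trans to ≈-trans)

module ≈-Reasoning = SetoidReasoning ≈-setoid

0S : Series
0S _ = 0ℚ

⊕-cong : ∀ {f f′ g g′} → f ≈ f′ → g ≈ g′ → f ⊕ g ≈ f′ ⊕ g′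
⊕-cong p q = coeffwise (λ a → cong₂ _+_ (coeff p a) (coeff q a))

⊗-cong : ∀ {f f′ g g′} → f ≈ f′ → g ≈ g′ → f ⊗ g ≈ f′ ⊗ g′
⊗-cong p q = coeffwise (λ a → conv-cong a (λ b c → cong₂ _*_ (coeff p b) (coeff q c)))

⊗-congˡ : ∀ {f g g′} → g ≈ g′ → f ⊗ g ≈ f ⊗ g′
⊗-congˡ {f} = ⊗-cong {f} {f} ≈-refl

⊗-congʳ : ∀ {f f′ g} → f ≈ f′ → f ⊗ g ≈ f′ ⊗ g
⊗-congʳ {g = g} p = ⊗-cong {g = g} {g} p ≈-refl

neg-cong : ∀ {f f′} → f ≈ f′ → neg f ≈ neg f′
neg-cong p = coeffwise (λ a → cong -_ (coeff p a))

⊕-assoc : ∀ f g h → (f ⊕ g) ⊕ h ≈ f ⊕ (g ⊕ h)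
⊕-assoc f g h = coeffwise (λ a → ℚP.+-assoc (f a) (g a) (h a))

⊕-comm : ∀ f g → f ⊕ g ≈ g ⊕ f
⊕-comm f g = coeffwise (λ a → ℚP.+-comm (f a) (g a))

⊕-identityˡ : ∀ f → 0S ⊕ f ≈ f
⊕-identityˡ f = coeffwise (λ a → ℚP.+-identityˡ (f a))

⊗-comm : ∀ f g → f ⊗ g ≈ g ⊗ f
⊗-comm f g = coeffwise λ a →
  trans (conv-comm (λ b c → f b * g c) a) (conv-cong a (λ b c → ℚP.*-comm (f c) (g b)))

⊗-assoc : ∀ f g h → (f ⊗ g) ⊗ h ≈ f ⊗ (g ⊗ h)
⊗-assoc f g h = coeffwise λ a → begin
  conv (λ x d → conv (λ b c → f b * g c) x * h d) a
    ≡⟨ conv-cong a (λ x d → conv-*ʳ (λ b c → f b * g c) (h d) x) ⟩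
  conv (λ x d → conv (λ b c → f b * g c * h d) x) a
    ≡⟨ conv-assoc (λ b c d → f b * g c * h d) a ⟩
  conv (λ b y → conv (λ c d → f b * g c * h d) y) a
    ≡⟨ conv-cong a (λ b y → trans (conv-cong y (λ c d → ℚP.*-assoc (f b) (g c) (h d)))
                                  (conv-*ˡ (f b) (λ c d → g c * h d) y)) ⟩
  conv (λ b y → f b * conv (λ c d → g c * h d) y) a ∎
  where open ≡-Reasoning

const-⊗ : ∀ q f a → (const q ⊗ f) a ≡ q * f a
const-⊗ q f = conv-unitˡ q (λ _ c → f c)

⊗-identityˡ : ∀ f → one ⊗ f ≈ f
⊗-identityˡ f = coeffwise (λ a → trans (const-⊗ 1ℚ f a) (ℚP.*-identityˡ (f a)))

⊗-zeroˡ : ∀ f → 0S ⊗ f ≈ 0S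
⊗-zeroˡ f = coeffwise (λ a → conv-zero _ a (λ b c _ → ℚP.*-zeroˡ (f c)))

⊗-distribʳ : ∀ f g h → (g ⊕ h) ⊗ f ≈ (g ⊗ f) ⊕ (h ⊗ f)
⊗-distribʳ f g h = coeffwise λ a →
  trans (conv-cong a (λ b c → ℚP.*-distribʳ-+ (f c) (g b) (h b)))
        (conv-+ (λ b c → g b * f c) (λ b c → h b * f c) a)

neg-⊗ : ∀ f g → neg f ⊗ g ≈ neg (f ⊗ g)
neg-⊗ f g = coeffwise (λ a →
  trans (conv-cong a (λ b c → sym (ℚP.neg-distribˡ-* (f b) (g c)))) (conv-neg (λ b c → f b * g c) a))

neg-⊕ : ∀ f g → neg f ⊕ neg g ≈ neg (f ⊕ g)
neg-⊕ f g = coeffwise (λ a → sym (ℚP.neg-distrib-+ (f a) (g a)))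

⊕-isSemigroup : AS.IsSemigroup _≈_ _⊕_
⊕-isSemigroup = record
  { isMagma = record { isEquivalence = ≈-isEquivalence ; ∙-cong = ⊕-cong } ; assoc = ⊕-assoc }

⊗-isSemigroup : AS.IsSemigroup _≈_ _⊗_
⊗-isSemigroup = record
  { isMagma = record { isEquivalence = ≈-isEquivalence ; ∙-cong = ⊗-cong } ; assoc = ⊗-assoc }

⊕-⊗-isCommutativeSemiring : AS.IsCommutativeSemiring _≈_ _⊕_ _⊗_ 0S one
⊕-⊗-isCommutativeSemiring = isCommutativeSemiringˡ record
  { +-isCommutativeMonoid = isCommutativeMonoidˡ record
      { isSemigroup = ⊕-isSemigroup ; identityˡ = ⊕-identityˡ ; comm = ⊕-comm }
  ; *-isCommutativeMonoid = isCommutativeMonoidˡ record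
      { isSemigroup = ⊗-isSemigroup ; identityˡ = ⊗-identityˡ ; comm = ⊗-comm }
  ; distribʳ = ⊗-distribʳ
  ; zeroˡ    = ⊗-zeroˡ
  }

series-ring : AlmostCommutativeRing 0ℓ 0ℓ
series-ring = record
  { Carrier = Series
  ; _≈_     = _≈_
  ; _+_     = _⊕_
  ; _*_     = _⊗_
  ; -_      = neg
  ; 0#      = 0S
  ; 0≟_     = λ _ → nothing
  ; 1#      = one
  ; isAlmostCommutativeRing = record
    { isCommutativeSemiring = ⊕-⊗-isCommutativeSemiring
    ; -‿cong       = neg-cong
    ; -‿*-distribˡ = neg-⊗
    ; -‿+-comm     = neg-⊕ } }

const-+ : ∀ p q → const (p + q) ≈ const p ⊕ const q
const-+ p q = coeffwise λ a → lemma (deg a ≤ᵇ 0)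
  where
  lemma : ∀ β → (if β then p + q else 0ℚ) ≡ (if β then p else 0ℚ) + (if β then q else 0ℚ)
  lemma true  = refl
  lemma false = sym (ℚP.+-identityˡ 0ℚ)

const-neg : ∀ p → const (- p) ≈ neg (const p)
const-neg p = coeffwise λ a → lemma (deg a ≤ᵇ 0)
  where
  lemma : ∀ β → (if β then - p else 0ℚ) ≡ - (if β then p else 0ℚ)
  lemma true  = refl
  lemma false = refl

const-* : ∀ p q → const (p * q) ≈ const p ⊗ const q
const-* p q = coeffwise λ a → trans (lemma (deg a ≤ᵇ 0)) (sym (const-⊗ p (const q) a))
  where
  lemma : ∀ β → (if β then p * q else 0ℚ) ≡ p * (if β then q else 0ℚ)
  lemma true  = refl
  lemma false = sym (ℚP.*-zeroʳ p)

const-0 : const 0ℚ ≈ 0S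
const-0 = coeffwise λ a → lemma (deg a ≤ᵇ 0)
  where
  lemma : ∀ β → (if β then 0ℚ else 0ℚ) ≡ 0ℚ
  lemma true  = refl
  lemma false = refl

ℤ→series : Homomorphism 0ℓ 0ℓ 0ℓ 0ℓ
ℤ→series = record
  { from = record { rawRing = ℤ.+-*-rawRing ; isZero = isZero }
  ; to = series-ring
  ; morphism = record
    { ⟦_⟧    = λ z → const (ιℤ z)
    ; +-homo = λ x y → ≈-trans (const-cong (ιℤ-+ x y)) (const-+ (ιℤ x) (ιℤ y))
    ; *-homo = λ x y → ≈-trans (const-cong (ιℤ-* x y)) (const-* (ιℤ x) (ιℤ y))
    ; -‿homo = λ x → ≈-trans (const-cong (ιℤ-neg x)) (const-neg (ιℤ x))
    ; 0-homo = const-0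
    ; 1-homo = ≈-refl }
  ; Zero-C⟶Zero-R = zero-homo }
  where
  isZero : ℤ → Bool
  isZero (ℤ.+ zero) = true
  isZero _          = false
  const-cong : ∀ {p q} → p ≡ q → const p ≈ const q
  const-cong refl = ≈-refl
  zero-homo : ∀ x → T (isZero x) → 0S ≈ const (ιℤ x)
  zero-homo (ℤ.+ zero) _ = ≈-sym const-0

-- Polynomial identities between series, decided by normalisation

infixl 6 _:+_ _:-_
infixl 7 _:*_
infix 8 :-_

data Expr (n : ℕ) : Set where
  K    : ℤ → Expr n
  I    : Fin n → Expr n
  _:+_ : Expr n → Expr n → Expr n
  _:*_ : Expr n → Expr n → Expr n
  :-_  : Expr n → Expr n

_:-_ : ∀ {n} → Expr n → Expr n → Expr n
e :- e′ = e :+ :- e′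

K0 K1 K2 : ∀ {n} → Expr n
K0 = K (ℤ.+ 0)
K1 = K (ℤ.+ 1)
K2 = K (ℤ.+ 2)

⟦_⟧ : ∀ {n} → Expr n → Vec Series n → Series
⟦ K z ⟧     ρ = const (ιℤ z)
⟦ I i ⟧     ρ = lookup ρ i
⟦ e :+ e′ ⟧ ρ = ⟦ e ⟧ ρ ⊕ ⟦ e′ ⟧ ρ
⟦ e :* e′ ⟧ ρ = ⟦ e ⟧ ρ ⊗ ⟦ e′ ⟧ ρ
⟦ :- e ⟧    ρ = neg (⟦ e ⟧ ρ)

⟦⟧-cong : ∀ {n} (e : Expr n) {ρ ρ′ : Vec Series n} →
  (∀ i → lookup ρ i ≈ lookup ρ′ i) → ⟦ e ⟧ ρ ≈ ⟦ e ⟧ ρ′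
⟦⟧-cong (K z)     h = ≈-refl
⟦⟧-cong (I i)     h = h i
⟦⟧-cong (e :+ e′) h = ⊕-cong (⟦⟧-cong e h) (⟦⟧-cong e′ h)
⟦⟧-cong (e :* e′) h = ⊗-cong (⟦⟧-cong e h) (⟦⟧-cong e′ h)
⟦⟧-cong (:- e)    h = neg-cong (⟦⟧-cong e h)

module _ where
  open import Tactic.RingSolver.Core.Polynomial.Base (Homomorphism.from ℤ→series)
    using (Poly; κ; ⊟_) renaming (ι to ιₚ; _⊞_ to _⊞ₚ_; _⊠_ to _⊠ₚ_)
  open import Tactic.RingSolver.Core.Polynomial.Semantics ℤ→series renaming (⟦_⟧ to ⟦_⟧ₚ)
  open import Tactic.RingSolver.Core.Polynomial.Homomorphism ℤ→series

  normalise : ∀ {n} → Expr n → Poly n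
  normalise (K z)     = κ z
  normalise (I i)     = ιₚ i
  normalise (e :+ e′) = normalise e ⊞ₚ normalise e′
  normalise (e :* e′) = normalise e ⊠ₚ normalise e′
  normalise (:- e)    = ⊟ normalise e

  normalise-correct : ∀ {n} (e : Expr n) ρ → ⟦ normalise e ⟧ₚ ρ ≈ ⟦ e ⟧ ρ
  normalise-correct (K z)     ρ = κ-hom z ρ
  normalise-correct (I i)     ρ = ι-hom i ρ
  normalise-correct (e :+ e′) ρ =
    ≈-trans (⊞-hom (normalise e) (normalise e′) ρ) (⊕-cong (normalise-correct e ρ) (normalise-correct e′ ρ))
  normalise-correct (e :* e′) ρ =
    ≈-trans (⊠-hom (normalise e) (normalise e′) ρ) (⊗-cong (normalise-correct e ρ) (normalise-correct e′ ρ))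
  normalise-correct (:- e)    ρ = ≈-trans (⊟-hom (normalise e) ρ) (neg-cong (normalise-correct e ρ))

  solve : ∀ {n} (e e′ : Expr n) → normalise e ≡ normalise e′ → ∀ ρ → ⟦ e ⟧ ρ ≈ ⟦ e′ ⟧ ρ
  solve e e′ eq ρ = ≈-trans (≈-sym (normalise-correct e ρ))
    (≈-trans (≈-reflexive (cong (λ p → ⟦ p ⟧ₚ ρ) eq)) (normalise-correct e′ ρ))
    where
    ≈-reflexive : ∀ {f g} → f ≡ g → f ≈ g
    ≈-reflexive refl = ≈-refl

Multiple : ℕ → Set
Multiple n = Expr n × Expr n × Expr n

holds : ∀ {n} → Vec Series n → Multiple n → Set
holds ρ (_ , l , r) = ⟦ l ⟧ ρ ≈ ⟦ r ⟧ ρ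

Hypothesis : ∀ {n} → Vec Series n → Set
Hypothesis {n} ρ = Σ (Multiple n) (holds ρ)

Σmultiples : ∀ {n} {ρ : Vec Series n} → List (Hypothesis ρ) → Expr n
Σmultiples []                    = K0
Σmultiples (((c , l , r) , _) ∷ hs) = c :* (l :- r) :+ Σmultiples hs

Σmultiples≈0 : ∀ {n} {ρ : Vec Series n} (hs : List (Hypothesis ρ)) → ⟦ Σmultiples hs ⟧ ρ ≈ 0S
Σmultiples≈0 []                          = const-0
Σmultiples≈0 {ρ = ρ} (((c , l , r) , l≈r) ∷ hs) = coeffwise λ a → trans
  (cong₂ _+_ (conv-zero _ a (λ b d _ → multiple≡0 b d)) (coeff (Σmultiples≈0 hs) a))
  (ℚP.+-identityʳ 0ℚ)
  where
  multiple≡0 : ∀ b d → ⟦ c ⟧ ρ b * (⟦ l ⟧ ρ d - ⟦ r ⟧ ρ d) ≡ 0ℚ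
  multiple≡0 b d = trans (cong (λ t → ⟦ c ⟧ ρ b * (t - ⟦ r ⟧ ρ d)) (coeff l≈r d))
    (trans (cong (⟦ c ⟧ ρ b *_) (ℚP.+-inverseʳ (⟦ r ⟧ ρ d))) (ℚP.*-zeroʳ (⟦ c ⟧ ρ b)))

solve-modulo : ∀ {n} {ρ : Vec Series n} (e e′ : Expr n) (hs : List (Hypothesis ρ)) →
  normalise e ≡ normalise (e′ :+ Σmultiples hs) → ⟦ e ⟧ ρ ≈ ⟦ e′ ⟧ ρ
solve-modulo {ρ = ρ} e e′ hs eq = begin
  ⟦ e ⟧ ρ                          ≈⟨ solve e (e′ :+ Σmultiples hs) eq ρ ⟩
  ⟦ e′ ⟧ ρ ⊕ ⟦ Σmultiples hs ⟧ ρ   ≈⟨ ⊕-cong (≈-refl {⟦ e′ ⟧ ρ}) (Σmultiples≈0 hs) ⟩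
  ⟦ e′ ⟧ ρ ⊕ 0S                    ≈⟨ coeffwise (λ a → ℚP.+-identityʳ _) ⟩
  ⟦ e′ ⟧ ρ                         ∎
  where open ≈-Reasoning

-- Euler operators

pattern 0F = Fin.zero
pattern 1F = Fin.suc 0F
pattern 2F = Fin.suc 1F
pattern 3F = Fin.suc 2F
pattern 4F = Fin.suc 3F
pattern 5F = Fin.suc 4F

θ : Fin 6 → Series → Series
θ j f a = ι (lookup a j) * f a

θ-cong : ∀ j {f g} → f ≈ g → θ j f ≈ θ j g
θ-cong j p = coeffwise (λ a → cong (ι (lookup a j) *_) (coeff p a))

θ-⊕ : ∀ j f g → θ j (f ⊕ g) ≈ θ j f ⊕ θ j g
θ-⊕ j f g = coeffwise (λ a → ℚP.*-distribˡ-+ (ι (lookup a j)) (f a) (g a))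

θ-neg : ∀ j f → θ j (neg f) ≈ neg (θ j f)
θ-neg j f = coeffwise (λ a → sym (ℚP.neg-distribʳ-* (ι (lookup a j)) (f a)))

θ-⊗ : ∀ j f g → θ j (f ⊗ g) ≈ θ j f ⊗ g ⊕ f ⊗ θ j g
θ-⊗ j f g = coeffwise λ a → begin
  ι (lookup a j) * conv (λ b c → f b * g c) a
    ≡⟨ sym (conv-*ˡ (ι (lookup a j)) (λ b c → f b * g c) a) ⟩
  conv (λ b c → ι (lookup a j) * (f b * g c)) a
    ≡⟨ conv-ext a (λ b c b⊞c≡a → cong (λ t → ι t * (f b * g c)) (lookup-⊞ j b⊞c≡a)) ⟩
  conv (λ b c → ι (lookup b j ℕ.+ lookup c j) * (f b * g c)) a
    ≡⟨ conv-cong a (λ b c → distrib (lookup b j) (lookup c j) (f b) (g c)) ⟩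
  conv (λ b c → ι (lookup b j) * f b * g c + f b * (ι (lookup c j) * g c)) a
    ≡⟨ conv-+ (λ b c → ι (lookup b j) * f b * g c) (λ b c → f b * (ι (lookup c j) * g c)) a ⟩
  (θ j f ⊗ g ⊕ f ⊗ θ j g) a ∎
  where
  open ≡-Reasoning
  distrib : ∀ m n x y → ι (m ℕ.+ n) * (x * y) ≡ ι m * x * y + x * (ι n * y)
  distrib m n x y = trans (cong (_* (x * y)) (ι-+ m n))
    (ℚS.solve 4 (λ m n x y → (m ℚS.:+ n) ℚS.:* (x ℚS.:* y) ℚS.:= m ℚS.:* x ℚS.:* y ℚS.:+ x ℚS.:* (n ℚS.:* y))
                refl (ι m) (ι n) x y)

θ-const : ∀ j q → θ j (const q) ≈ 0S
θ-const j q = coeffwise λ a → lemma a (deg a ≤ᵇ 0) refl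
  where
  lemma : ∀ a β → (deg a ≤ᵇ 0) ≡ β → ι (lookup a j) * (if β then q else 0ℚ) ≡ 0ℚ
  lemma a false _   = ℚP.*-zeroʳ (ι (lookup a j))
  lemma a true  a≤0 = trans (cong (λ t → ι t * q) lookup≡0) (ℚP.*-zeroˡ q)
    where
    lookup≡0 : lookup a j ≡ 0
    lookup≡0 = trans (cong (λ b → lookup b j) (degV≡0⇒≡0 a deg≡0)) (VecP.lookup-replicate j 0)
      where
      deg≡0 : deg a ≡ 0
      deg≡0 = ℕP.n≤0⇒n≡0 (ℕP.≤ᵇ⇒≤ (deg a) 0 (subst T (sym a≤0) _))

basis : Fin 6 → Mono
basis i = updateAt (replicate 6 0) i (λ _ → 1)

var≡𝟙 : ∀ i a → var i a ≡ 𝟙 (a ≡ᵇᵛ basis i)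
var≡𝟙 0F (_ ∷ _ ∷ _ ∷ _ ∷ _ ∷ _ ∷ []) = refl
var≡𝟙 1F (_ ∷ _ ∷ _ ∷ _ ∷ _ ∷ _ ∷ []) = refl
var≡𝟙 2F (_ ∷ _ ∷ _ ∷ _ ∷ _ ∷ _ ∷ []) = refl
var≡𝟙 3F (_ ∷ _ ∷ _ ∷ _ ∷ _ ∷ _ ∷ []) = refl
var≡𝟙 4F (_ ∷ _ ∷ _ ∷ _ ∷ _ ∷ _ ∷ []) = refl
var≡𝟙 5F (_ ∷ _ ∷ _ ∷ _ ∷ _ ∷ _ ∷ []) = refl

var-⊗ : ∀ i G a → (var i ⊗ G) a ≡ offset (basis i) a (λ _ c → G c)
var-⊗ i G a =
  trans (conv-cong a (λ b c → cong (_* G c) (var≡𝟙 i b))) (conv-𝟙 (basis i) (λ _ c → G c) a)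

θ-var : ∀ j i → θ j (var i) ≈ (if does (i Fin.≟ j) then var i else 0S)
θ-var j i = coeffwise λ a → trans (cong (ι (lookup a j) *_) (var≡𝟙 i a)) (lemma a (a ≡ᵇᵛ basis i) refl)
  where
  lemma : ∀ a β → (a ≡ᵇᵛ basis i) ≡ β → ι (lookup a j) * 𝟙 β ≡ (if does (i Fin.≟ j) then var i else 0S) a
  lemma a false a≢eᵢ with i Fin.≟ j
  ... | yes _ = trans (ℚP.*-zeroʳ (ι (lookup a j))) (trans (cong 𝟙 (sym a≢eᵢ)) (sym (var≡𝟙 i a)))
  ... | no  _ = ℚP.*-zeroʳ (ι (lookup a j))
  lemma a true a≡eᵢ with ≡ᵇᵛ⇒≡ a (basis i) (subst T (sym a≡eᵢ) _)
  ... | refl with i Fin.≟ j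
  ...   | yes refl = trans (cong (λ t → ι t * 1ℚ) (VecP.lookup∘updateAt i (replicate 6 0)))
                          (trans (cong 𝟙 (sym a≡eᵢ)) (sym (var≡𝟙 i (basis i))))
  ...   | no  i≢j  = cong (λ t → ι t * 1ℚ) (trans (VecP.lookup∘updateAt′ j i (λ j≡i → i≢j (sym j≡i)) (replicate 6 0))
                                                 (VecP.lookup-replicate j 0))

vars : Vec Series 6
vars = U ∷ V ∷ W ∷ X ∷ Y ∷ Z ∷ []

lookup-vars : ∀ i → lookup vars i ≡ var i
lookup-vars 0F = refl
lookup-vars 1F = refl
lookup-vars 2F = refl
lookup-vars 3F = refl
lookup-vars 4F = refl
lookup-vars 5F = refl

⟦_⟧ᵥ : Expr 6 → Series
⟦ e ⟧ᵥ = ⟦ e ⟧ vars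

θₑ : Fin 6 → Expr 6 → Expr 6
θₑ j (K z)     = K0
θₑ j (I i)     = if does (i Fin.≟ j) then I i else K0
θₑ j (e :+ e′) = θₑ j e :+ θₑ j e′
θₑ j (e :* e′) = θₑ j e :* e′ :+ e :* θₑ j e′
θₑ j (:- e)    = :- θₑ j e

θₑ-correct : ∀ j e → θ j ⟦ e ⟧ᵥ ≈ ⟦ θₑ j e ⟧ᵥ
θₑ-correct j (K z)     = ≈-trans (θ-const j (ιℤ z)) (≈-sym const-0)
θₑ-correct j (I i)     = coeffwise λ a →
  trans (cong (λ f → θ j f a) (lookup-vars i)) (trans (coeff (θ-var j i) a) (lemma (does (i Fin.≟ j)) a))
  where
  lemma : ∀ β a → (if β then var i else 0S) a ≡ ⟦ if β then I i else K0 ⟧ᵥ a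
  lemma true  a = cong (λ f → f a) (sym (lookup-vars i))
  lemma false a = sym (coeff const-0 a)
θₑ-correct j (e :+ e′) =
  ≈-trans (θ-⊕ j ⟦ e ⟧ᵥ ⟦ e′ ⟧ᵥ) (⊕-cong (θₑ-correct j e) (θₑ-correct j e′))
θₑ-correct j (e :* e′) = ≈-trans (θ-⊗ j ⟦ e ⟧ᵥ ⟦ e′ ⟧ᵥ)
  (⊕-cong (⊗-congʳ {g = ⟦ e′ ⟧ᵥ} (θₑ-correct j e)) (⊗-congˡ {⟦ e ⟧ᵥ} (θₑ-correct j e′)))
θₑ-correct j (:- e)    = ≈-trans (θ-neg j ⟦ e ⟧ᵥ) (neg-cong (θₑ-correct j e))

-- Substituting a constant-free series into a power series

ConstantFree : Series → Set
ConstantFree t = t (replicate 6 0) ≡ 0ℚ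

constantFree-deg0 : ∀ {t} → ConstantFree t → ∀ b → deg b ≡ 0 → t b ≡ 0ℚ
constantFree-deg0 {t} t₀≡0 b b≡0 = trans (cong t (degV≡0⇒≡0 b b≡0)) t₀≡0

θ-constantFree : ∀ j t → ConstantFree (θ j t)
θ-constantFree j t =
  trans (cong (λ n → ι n * t (replicate 6 0)) (VecP.lookup-replicate j 0)) (ℚP.*-zeroˡ (t (replicate 6 0)))

⊗-vanishes-below : ∀ h g n a → ConstantFree h → (∀ c → deg c < n → g c ≡ 0ℚ) →
  deg a < suc n → (h ⊗ g) a ≡ 0ℚ
⊗-vanishes-below h g n a h₀≡0 g≡0 a<1+n = conv-zero _ a term
  where
  term : ∀ b c → b ⊞ c ≡ a → h b * g c ≡ 0ℚ
  term b c b⊞c≡a with deg b ℕ.≟ 0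
  ... | yes b≡0 = trans (cong (_* g c) (constantFree-deg0 {h} h₀≡0 b b≡0)) (ℚP.*-zeroˡ (g c))
  ... | no  b≢0 = trans (cong (h b *_) (g≡0 c c<n)) (ℚP.*-zeroʳ (h b))
    where
    a≡b+c : deg a ≡ deg b ℕ.+ deg c
    a≡b+c = trans (cong degV (sym b⊞c≡a)) (degV-⊞ b c)
    c<n : deg c < n
    c<n = ℕP.≤-trans (ℕP.+-monoˡ-≤ (deg c) (ℕP.n≢0⇒n>0 b≢0)) (ℕP.≤-pred (subst (_< suc n) a≡b+c a<1+n))

pow-vanishes-below : ∀ t → ConstantFree t → ∀ n a → deg a < n → pow t n a ≡ 0ℚ
pow-vanishes-below t t₀≡0 (suc n) a a<1+n =
  ⊗-vanishes-below t (pow t n) n a t₀≡0 (pow-vanishes-below t t₀≡0 n) a<1+n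

⊗-constantFree : ∀ h f → ConstantFree h → ConstantFree (h ⊗ f)
⊗-constantFree h f h-constantFree = ⊗-vanishes-below h f 0 (replicate 6 0) h-constantFree (λ _ ()) (s≤s z≤n)

-- c(t) = Σₙ cₙ tⁿ: only n ≤ deg a contributes to the coefficient of a.
compose : (ℕ → ℚ) → Series → Series
compose c t a = Σ< (suc (deg a)) (λ n → c n * pow t n a)

compose-truncation : ∀ c t → ConstantFree t → ∀ a N → deg a ≤ N →
  Σ< (suc N) (λ n → c n * pow t n a) ≡ compose c t a
compose-truncation c t t₀≡0 a N a≤N = begin
  Σ< (suc N) f                                             ≡⟨ cong (λ m → Σ< m f) (sym (ℕP.m+[n∸m]≡n (s≤s a≤N))) ⟩
  Σ< (suc (deg a) ℕ.+ r) f                                 ≡⟨ Σ<-split (suc (deg a)) r f ⟩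
  Σ< (suc (deg a)) f + Σ< r (λ k → f (suc (deg a) ℕ.+ k))  ≡⟨ cong (Σ< (suc (deg a)) f +_) (Σ<-zero r _ tail≡0) ⟩
  Σ< (suc (deg a)) f + 0ℚ                                  ≡⟨ ℚP.+-identityʳ _ ⟩
  compose c t a                                            ∎
  where
  open ≡-Reasoning
  r : ℕ
  r = suc N ∸ suc (deg a)
  f : ℕ → ℚ
  f n = c n * pow t n a
  tail≡0 : ∀ k → f (suc (deg a) ℕ.+ k) ≡ 0ℚ
  tail≡0 k = trans (cong (c (suc (deg a) ℕ.+ k) *_)
                     (pow-vanishes-below t t₀≡0 (suc (deg a) ℕ.+ k) a (s≤s (ℕP.m≤m+n (deg a) k))))
                   (ℚP.*-zeroʳ (c (suc (deg a) ℕ.+ k)))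

⊗-compose : ∀ h c t → ConstantFree t → ∀ a →
  (h ⊗ compose c t) a ≡ Σ< (suc (deg a)) (λ n → c n * (h ⊗ pow t n) a)
⊗-compose h c t t₀≡0 a = begin
  conv (λ b d → h b * compose c t d) a
    ≡⟨ conv-ext a (λ b d b⊞d≡a →
         cong (h b *_) (sym (compose-truncation c t t₀≡0 d (deg a) (d≤a b d b⊞d≡a)))) ⟩
  conv (λ b d → h b * Σ< (suc (deg a)) (λ n → c n * pow t n d)) a
    ≡⟨ conv-cong a (λ b d → trans (sym (Σ<-*ˡ (suc (deg a)) (h b) (λ n → c n * pow t n d)))
                                  (Σ<-congf (suc (deg a)) (λ n → x∙yz≈y∙xz (h b) (c n) (pow t n d)))) ⟩
  conv (λ b d → Σ< (suc (deg a)) (λ n → c n * (h b * pow t n d))) a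
    ≡⟨ conv-Σ<-comm (suc (deg a)) (λ n b d → c n * (h b * pow t n d)) a ⟩
  Σ< (suc (deg a)) (λ n → conv (λ b d → c n * (h b * pow t n d)) a)
    ≡⟨ Σ<-congf (suc (deg a)) (λ n → conv-*ˡ (c n) (λ b d → h b * pow t n d) a) ⟩
  Σ< (suc (deg a)) (λ n → c n * (h ⊗ pow t n) a) ∎
  where
  open ≡-Reasoning
  d≤a : ∀ b d → b ⊞ d ≡ a → deg d ≤ deg a
  d≤a b d b⊞d≡a = subst (deg d ≤_) (trans (sym (degV-⊞ b d)) (cong degV b⊞d≡a)) (ℕP.m≤n+m (deg d) (deg b))

shift : (ℕ → ℚ) → ℕ → ℚ
shift c zero    = 0ℚ
shift c (suc n) = c n

⊗-compose-shift : ∀ c t → ConstantFree t → t ⊗ compose c t ≈ compose (shift c) t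
⊗-compose-shift c t t₀≡0 = coeffwise λ a → begin
  (t ⊗ compose c t) a                             ≡⟨ ⊗-compose t c t t₀≡0 a ⟩
  Σ< (suc (deg a)) (shifted a)                    ≡⟨ Σ<-last-zero (deg a) (shifted a) (top≡0 a) ⟩
  Σ< (deg a) (shifted a)                          ≡⟨ sym (ℚP.+-identityˡ _) ⟩
  0ℚ + Σ< (deg a) (shifted a)                     ≡⟨ cong (_+ Σ< (deg a) (shifted a)) (sym (ℚP.*-zeroˡ (pow t 0 a))) ⟩
  compose (shift c) t a                           ∎
  where
  open ≡-Reasoning
  shifted : Mono → ℕ → ℚ
  shifted a n = c n * pow t (suc n) a
  top≡0 : ∀ a → shifted a (deg a) ≡ 0ℚ
  top≡0 a = trans (cong (c (deg a) *_) (pow-vanishes-below t t₀≡0 (suc (deg a)) a (ℕP.n<1+n (deg a))))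
                  (ℚP.*-zeroʳ (c (deg a)))

compose-cong : ∀ c d t → (∀ n → c n ≡ d n) → compose c t ≈ compose d t
compose-cong c d t c≡d = coeffwise (λ a → Σ<-congf (suc (deg a)) (λ n → cong (_* pow t n a) (c≡d n)))

compose-⊕ : ∀ c d t → compose c t ⊕ compose d t ≈ compose (λ n → c n + d n) t
compose-⊕ c d t = coeffwise λ a →
  trans (sym (Σ<-+ (suc (deg a)) (λ n → c n * pow t n a) (λ n → d n * pow t n a)))
        (Σ<-congf (suc (deg a)) (λ n → sym (ℚP.*-distribʳ-+ (pow t n a) (c n) (d n))))

compose-neg : ∀ c t → neg (compose c t) ≈ compose (λ n → - c n) t
compose-neg c t = coeffwise λ a →
  trans (sym (Σ<-neg (suc (deg a)) (λ n → c n * pow t n a)))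
        (Σ<-congf (suc (deg a)) (λ n → ℚP.neg-distribˡ-* (c n) (pow t n a)))

const-⊗-compose : ∀ q c t → const q ⊗ compose c t ≈ compose (λ n → q * c n) t
const-⊗-compose q c t = coeffwise λ a → trans (const-⊗ q (compose c t) a)
  (trans (sym (Σ<-*ˡ (suc (deg a)) q (λ n → c n * pow t n a)))
         (Σ<-congf (suc (deg a)) (λ n → sym (ℚP.*-assoc q (c n) (pow t n a)))))

δ₀ : ℕ → ℚ
δ₀ zero    = 1ℚ
δ₀ (suc n) = 0ℚ

compose-δ₀ : ∀ t → compose δ₀ t ≈ one
compose-δ₀ t = coeffwise λ a → trans
  (cong₂ _+_ (ℚP.*-identityˡ (one a)) (Σ<-zero (deg a) _ (λ n → ℚP.*-zeroˡ (pow t (suc n) a))))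
  (ℚP.+-identityʳ (one a))

nat-suc : ∀ n → nat (suc n) ≈ one ⊕ nat n
nat-suc n = coeffwise λ a → trans (cong (λ q → const q a) (ι-suc n)) (coeff (const-+ 1ℚ (ι n)) a)

θ-one : ∀ j → θ j one ≈ ⟦ K0 ⟧ᵥ
θ-one j = ≈-trans (θ-const j 1ℚ) (≈-sym const-0)

θ-pow : ∀ j t n → θ j (pow t (suc n)) ≈ nat (suc n) ⊗ (θ j t ⊗ pow t n)
θ-pow j t zero = begin
  θ j (t ⊗ one)                ≈⟨ θ-⊗ j t one ⟩
  θ j t ⊗ one ⊕ t ⊗ θ j one    ≈⟨ ⊕-cong (≈-refl {θ j t ⊗ one}) (⊗-congˡ {t} (θ-one j)) ⟩
  θ j t ⊗ one ⊕ t ⊗ ⟦ K0 ⟧ᵥ    ≈⟨ solve (I 0F :* K1 :+ I 1F :* K0) (K1 :* (I 0F :* K1)) refl (θ j t ∷ t ∷ []) ⟩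
  nat 1 ⊗ (θ j t ⊗ one)        ∎
  where open ≈-Reasoning
θ-pow j t (suc n) = begin
  θ j (t ⊗ tⁿ⁺¹)                                     ≈⟨ θ-⊗ j t tⁿ⁺¹ ⟩
  θ j t ⊗ tⁿ⁺¹ ⊕ t ⊗ θ j tⁿ⁺¹                        ≈⟨ ⊕-cong (≈-refl {θ j t ⊗ tⁿ⁺¹}) (⊗-congˡ {t} (θ-pow j t n)) ⟩
  θ j t ⊗ tⁿ⁺¹ ⊕ t ⊗ (nat (suc n) ⊗ (θ j t ⊗ pow t n))
    ≈⟨ solve (I 0F :* (I 1F :* I 2F) :+ I 1F :* (I 3F :* (I 0F :* I 2F))) ((K1 :+ I 3F) :* (I 0F :* (I 1F :* I 2F)))
             refl (θ j t ∷ t ∷ pow t n ∷ nat (suc n) ∷ []) ⟩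
  (one ⊕ nat (suc n)) ⊗ (θ j t ⊗ tⁿ⁺¹)              ≈⟨ ⊗-congʳ {g = θ j t ⊗ tⁿ⁺¹} (≈-sym (nat-suc (suc n))) ⟩
  nat (suc (suc n)) ⊗ (θ j t ⊗ tⁿ⁺¹)                ∎
  where
  open ≈-Reasoning
  tⁿ⁺¹ : Series
  tⁿ⁺¹ = pow t (suc n)

∂ : (ℕ → ℚ) → ℕ → ℚ
∂ c n = ι (suc n) * c (suc n)

θ-compose : ∀ j c t → ConstantFree t → θ j (compose c t) ≈ θ j t ⊗ compose (∂ c) t
θ-compose j c t t₀≡0 = coeffwise λ a → begin
  ι (lookup a j) * Σ< (suc (deg a)) (λ n → c n * pow t n a)
    ≡⟨ sym (Σ<-*ˡ (suc (deg a)) (ι (lookup a j)) (λ n → c n * pow t n a)) ⟩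
  Σ< (suc (deg a)) (λ n → ι (lookup a j) * (c n * pow t n a))
    ≡⟨ Σ<-congf (suc (deg a)) (λ n → x∙yz≈y∙xz (ι (lookup a j)) (c n) (pow t n a)) ⟩
  c 0 * θ j one a + Σ< (deg a) (λ n → c (suc n) * θ j (pow t (suc n)) a)
    ≡⟨ cong₂ _+_ (trans (cong (c 0 *_) (coeff (θ-const j 1ℚ) a)) (ℚP.*-zeroʳ (c 0)))
                 (Σ<-congf (deg a) (λ n → θ-pow-coeff n a)) ⟩
  0ℚ + Σ< (deg a) (terms a)                 ≡⟨ ℚP.+-identityˡ _ ⟩
  Σ< (deg a) (terms a)                      ≡⟨ sym (Σ<-last-zero (deg a) (terms a) (top≡0 a)) ⟩
  Σ< (suc (deg a)) (terms a)                ≡⟨ sym (⊗-compose (θ j t) (∂ c) t t₀≡0 a) ⟩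
  (θ j t ⊗ compose (∂ c) t) a               ∎
  where
  open ≡-Reasoning
  terms : Mono → ℕ → ℚ
  terms a n = ∂ c n * (θ j t ⊗ pow t n) a
  θ-pow-coeff : ∀ n a → c (suc n) * θ j (pow t (suc n)) a ≡ terms a n
  θ-pow-coeff n a = begin
    c (suc n) * θ j (pow t (suc n)) a            ≡⟨ cong (c (suc n) *_) (coeff (θ-pow j t n) a) ⟩
    c (suc n) * (nat (suc n) ⊗ (θ j t ⊗ pow t n)) a
      ≡⟨ cong (c (suc n) *_) (const-⊗ (ι (suc n)) (θ j t ⊗ pow t n) a) ⟩
    c (suc n) * (ι (suc n) * (θ j t ⊗ pow t n) a) ≡⟨ sym (ℚP.*-assoc (c (suc n)) (ι (suc n)) _) ⟩
    (c (suc n) * ι (suc n)) * (θ j t ⊗ pow t n) a ≡⟨ cong (_* (θ j t ⊗ pow t n) a) (ℚP.*-comm (c (suc n)) (ι (suc n))) ⟩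
    terms a n                                     ∎
  top≡0 : ∀ a → terms a (deg a) ≡ 0ℚ
  top≡0 a = trans (cong (∂ c (deg a) *_) (⊗-vanishes-below (θ j t) (pow t (deg a)) (deg a) a
                    (θ-constantFree j t) (pow-vanishes-below t t₀≡0 (deg a)) (ℕP.n<1+n (deg a))))
                  (ℚP.*-zeroʳ (∂ c (deg a)))

pascal : ∀ n k → suc n C suc k ≡ n C k ℕ.+ n C suc k
pascal n k = sym (nCk+nC[k+1]≡[n+1]C[k+1] n k)

C-absorption : ∀ n k → (n C suc k) ℕ.* suc k ℕ.+ k ℕ.* (n C k) ≡ n ℕ.* (n C k)
C-absorption zero    zero    = refl
C-absorption zero    (suc k) = trans
  (cong₂ (λ x y → x ℕ.* (2 ℕ.+ k) ℕ.+ (1 ℕ.+ k) ℕ.* y)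
         (k>n⇒nCk≡0 {0} {2 ℕ.+ k} (s≤s z≤n)) (k>n⇒nCk≡0 {0} {1 ℕ.+ k} (s≤s z≤n)))
  (ℕP.*-zeroʳ (suc k))
C-absorption (suc n) zero    = trans (cong (λ x → x ℕ.* 1 ℕ.+ 0) (nC1≡n (suc n))) (ℕP.+-identityʳ _)
C-absorption (suc n) (suc k) = begin
  (suc n C (2 ℕ.+ k)) ℕ.* (2 ℕ.+ k) ℕ.+ (1 ℕ.+ k) ℕ.* (suc n C suc k)
    ≡⟨ cong₂ (λ x y → x ℕ.* (2 ℕ.+ k) ℕ.+ (1 ℕ.+ k) ℕ.* y) (pascal n (suc k)) (pascal n k) ⟩
  (c₁ ℕ.+ c₂) ℕ.* (2 ℕ.+ k) ℕ.+ (1 ℕ.+ k) ℕ.* (c₀ ℕ.+ c₁)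
    ≡⟨ ℕS.solve 4 (λ c₀ c₁ c₂ k →
         (c₁ ℕS.:+ c₂) ℕS.:* (ℕS.con 2 ℕS.:+ k) ℕS.:+ (ℕS.con 1 ℕS.:+ k) ℕS.:* (c₀ ℕS.:+ c₁)
         ℕS.:= (c₂ ℕS.:* (ℕS.con 2 ℕS.:+ k) ℕS.:+ (ℕS.con 1 ℕS.:+ k) ℕS.:* c₁)
               ℕS.:+ (c₁ ℕS.:+ (c₁ ℕS.:* (ℕS.con 1 ℕS.:+ k) ℕS.:+ k ℕS.:* c₀) ℕS.:+ c₀)) refl c₀ c₁ c₂ k ⟩
  (c₂ ℕ.* (2 ℕ.+ k) ℕ.+ (1 ℕ.+ k) ℕ.* c₁) ℕ.+ (c₁ ℕ.+ (c₁ ℕ.* (1 ℕ.+ k) ℕ.+ k ℕ.* c₀) ℕ.+ c₀)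
    ≡⟨ cong₂ (λ s t → s ℕ.+ (c₁ ℕ.+ t ℕ.+ c₀)) (C-absorption n (suc k)) (C-absorption n k) ⟩
  n ℕ.* c₁ ℕ.+ (c₁ ℕ.+ n ℕ.* c₀ ℕ.+ c₀)
    ≡⟨ ℕS.solve 3 (λ c₀ c₁ n → n ℕS.:* c₁ ℕS.:+ (c₁ ℕS.:+ n ℕS.:* c₀ ℕS.:+ c₀)
                                ℕS.:= (ℕS.con 1 ℕS.:+ n) ℕS.:* (c₀ ℕS.:+ c₁)) refl c₀ c₁ n ⟩
  (1 ℕ.+ n) ℕ.* (c₀ ℕ.+ c₁)
    ≡⟨ cong (suc n ℕ.*_) (sym (pascal n k)) ⟩
  suc n ℕ.* (suc n C suc k) ∎
  where
  open ≡-Reasoning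
  c₀ c₁ c₂ : ℕ
  c₀ = n C k
  c₁ = n C suc k
  c₂ = n C suc (suc k)

central-binomial-step : ∀ m →
  ((2 ℕ.* suc m) C suc m) ℕ.* (2 ℕ.* suc m) ≡ ((2 ℕ.* m) C m) ℕ.* (4 ℕ.* (1 ℕ.+ 2 ℕ.* m))
central-binomial-step m = begin
  ((2 ℕ.* suc m) C suc m) ℕ.* (2 ℕ.* suc m)
    ≡⟨ cong (λ n → (n C suc m) ℕ.* (2 ℕ.* suc m)) (ℕP.*-suc 2 m) ⟩
  (suc (suc (2 ℕ.* m)) C suc m) ℕ.* (2 ℕ.* suc m)
    ≡⟨ cong (ℕ._* (2 ℕ.* suc m)) (pascal (suc (2 ℕ.* m)) m) ⟩
  (suc (2 ℕ.* m) C m ℕ.+ a) ℕ.* (2 ℕ.* suc m)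
    ≡⟨ cong (λ x → (x ℕ.+ a) ℕ.* (2 ℕ.* suc m)) symmetric ⟩
  (a ℕ.+ a) ℕ.* (2 ℕ.* suc m)
    ≡⟨ ℕS.solve 2 (λ a m → (a ℕS.:+ a) ℕS.:* (ℕS.con 2 ℕS.:* (ℕS.con 1 ℕS.:+ m))
                            ℕS.:= ℕS.con 4 ℕS.:* (a ℕS.:* (ℕS.con 1 ℕS.:+ m))) refl a m ⟩
  4 ℕ.* (a ℕ.* suc m)
    ≡⟨ cong (4 ℕ.*_) a*[1+m] ⟩
  4 ℕ.* ((1 ℕ.+ 2 ℕ.* m) ℕ.* b)
    ≡⟨ ℕS.solve 2 (λ b m → ℕS.con 4 ℕS.:* ((ℕS.con 1 ℕS.:+ ℕS.con 2 ℕS.:* m) ℕS.:* b)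
                            ℕS.:= b ℕS.:* (ℕS.con 4 ℕS.:* (ℕS.con 1 ℕS.:+ ℕS.con 2 ℕS.:* m))) refl b m ⟩
  b ℕ.* (4 ℕ.* (1 ℕ.+ 2 ℕ.* m)) ∎
  where
  open ≡-Reasoning
  a b c : ℕ
  a = suc (2 ℕ.* m) C suc m
  b = (2 ℕ.* m) C m
  c = (2 ℕ.* m) C suc m
  m≤2m : m ≤ 2 ℕ.* m
  m≤2m = ℕP.m≤m+n m (m ℕ.+ 0)
  symmetric : suc (2 ℕ.* m) C m ≡ a
  symmetric = trans (nCk≡nC[n∸k] (ℕP.m≤n⇒m≤1+n m≤2m))
    (cong (suc (2 ℕ.* m) C_) (trans (ℕP.+-∸-assoc 1 m≤2m)
                                    (cong suc (trans (ℕP.m+n∸m≡n m (m ℕ.+ 0)) (ℕP.+-identityʳ m)))))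
  a*[1+m] : a ℕ.* suc m ≡ (1 ℕ.+ 2 ℕ.* m) ℕ.* b
  a*[1+m] = ℕP.+-cancelʳ-≡ (m ℕ.* b) _ _ (begin
    a ℕ.* suc m ℕ.+ m ℕ.* b
      ≡⟨ cong (λ x → x ℕ.* suc m ℕ.+ m ℕ.* b) (pascal (2 ℕ.* m) m) ⟩
    (b ℕ.+ c) ℕ.* suc m ℕ.+ m ℕ.* b
      ≡⟨ ℕS.solve 3 (λ b c m → (b ℕS.:+ c) ℕS.:* (ℕS.con 1 ℕS.:+ m) ℕS.:+ m ℕS.:* b
                               ℕS.:= b ℕS.:* (ℕS.con 1 ℕS.:+ m) ℕS.:+ (c ℕS.:* (ℕS.con 1 ℕS.:+ m) ℕS.:+ m ℕS.:* b)) refl b c m ⟩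
    b ℕ.* suc m ℕ.+ (c ℕ.* suc m ℕ.+ m ℕ.* b)
      ≡⟨ cong (b ℕ.* suc m ℕ.+_) (C-absorption (2 ℕ.* m) m) ⟩
    b ℕ.* suc m ℕ.+ 2 ℕ.* m ℕ.* b
      ≡⟨ ℕS.solve 2 (λ b m → b ℕS.:* (ℕS.con 1 ℕS.:+ m) ℕS.:+ ℕS.con 2 ℕS.:* m ℕS.:* b
                             ℕS.:= (ℕS.con 1 ℕS.:+ ℕS.con 2 ℕS.:* m) ℕS.:* b ℕS.:+ m ℕS.:* b) refl b m ⟩
    (1 ℕ.+ 2 ℕ.* m) ℕ.* b ℕ.+ m ℕ.* b ∎)

-- Reciprocal, inverse square root and exponential

expCoeff : ℕ → ℚ
expCoeff n = ((ℤ.+ 1) / (n !)) {{n ℕP.!≢0}}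

invSqrtCoeff : ℕ → ℚ
invSqrtCoeff n = ((ℤ.+ ((2 ℕ.* n) C n)) / (4 ℕ.^ n)) {{ℕP.m^n≢0 4 n}}

expCoeff-rec : ∀ n → ∂ expCoeff n ≡ expCoeff n
expCoeff-rec n = n*[1/d′]≡1/d (suc n) (n !) (suc n !) {{n ℕP.!≢0}} {{suc n ℕP.!≢0}} refl

invSqrtCoeff-rec : ∀ m → ι 2 * ∂ invSqrtCoeff m ≡ invSqrtCoeff m + ι 2 * (ι m * invSqrtCoeff m)
invSqrtCoeff-rec m = ι*-cancelˡ (4 ℕ.* P) {{ℕP.m^n≢0 4 (suc m)}} (begin
  ι (4 ℕ.* P) * (ι 2 * (ι (suc m) * c′))
    ≡⟨ ℚS.solve 4 (λ p t s c → p ℚS.:* (t ℚS.:* (s ℚS.:* c)) ℚS.:= (c ℚS.:* p) ℚS.:* (t ℚS.:* s))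
                  refl (ι (4 ℕ.* P)) (ι 2) (ι (suc m)) c′ ⟩
  (c′ * ι (4 ℕ.* P)) * (ι 2 * ι (suc m))
    ≡⟨ cong₂ _*_ ([z/d]*d≡z (ℤ.+ A) (4 ℕ.* P) {{ℕP.m^n≢0 4 (suc m)}}) (sym (ι-* 2 (suc m))) ⟩
  ι A * ι (2 ℕ.* suc m)                      ≡⟨ sym (ι-* A (2 ℕ.* suc m)) ⟩
  ι (A ℕ.* (2 ℕ.* suc m))                    ≡⟨ cong ι (central-binomial-step m) ⟩
  ι (B ℕ.* (4 ℕ.* (1 ℕ.+ 2 ℕ.* m)))          ≡⟨ ι-B*4[1+2m] ⟩
  ι B * (ι 4 * (1ℚ + ι 2 * ι m))
    ≡⟨ cong (_* (ι 4 * (1ℚ + ι 2 * ι m))) (sym ([z/d]*d≡z (ℤ.+ B) P {{ℕP.m^n≢0 4 m}})) ⟩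
  (c * ι P) * (ι 4 * (1ℚ + ι 2 * ι m))
    ≡⟨ ℚS.solve 5 (λ f p t m c → (c ℚS.:* p) ℚS.:* (f ℚS.:* (ℚS.con 1ℚ ℚS.:+ t ℚS.:* m))
                                  ℚS.:= (f ℚS.:* p) ℚS.:* (c ℚS.:+ t ℚS.:* (m ℚS.:* c)))
                  refl (ι 4) (ι P) (ι 2) (ι m) c ⟩
  (ι 4 * ι P) * (c + ι 2 * (ι m * c))        ≡⟨ cong (_* (c + ι 2 * (ι m * c))) (sym (ι-* 4 P)) ⟩
  ι (4 ℕ.* P) * (c + ι 2 * (ι m * c))        ∎)
  where
  open ≡-Reasoning
  P A B : ℕ
  P = 4 ℕ.^ m
  A = (2 ℕ.* suc m) C suc m
  B = (2 ℕ.* m) C m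
  c c′ : ℚ
  c = invSqrtCoeff m
  c′ = invSqrtCoeff (suc m)
  ι-B*4[1+2m] : ι (B ℕ.* (4 ℕ.* (1 ℕ.+ 2 ℕ.* m))) ≡ ι B * (ι 4 * (1ℚ + ι 2 * ι m))
  ι-B*4[1+2m] = trans (ι-* B (4 ℕ.* (1 ℕ.+ 2 ℕ.* m)))
    (cong (ι B *_) (trans (ι-* 4 (1 ℕ.+ 2 ℕ.* m)) (cong (ι 4 *_) (trans (ι-+ 1 (2 ℕ.* m)) (cong (1ℚ +_) (ι-* 2 m))))))

-- (1 - t)^(-1/2) is the power series f with f 0 = 1 and 2 (1 - t) f′ = f.
∂invSqrtCoeff-difference : ∀ n → ι 2 * (∂ invSqrtCoeff n - shift (∂ invSqrtCoeff) n) ≡ invSqrtCoeff n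
∂invSqrtCoeff-difference zero    = begin
  ι 2 * (c′ 0 - 0ℚ)            ≡⟨ cong (ι 2 *_) (ℚP.+-identityʳ (c′ 0)) ⟩
  ι 2 * c′ 0                   ≡⟨ invSqrtCoeff-rec 0 ⟩
  c 0 + ι 2 * (0ℚ * c 0)       ≡⟨ ℚS.solve 1 (λ x → x ℚS.:+ ℚS.con (ι 2) ℚS.:* (ℚS.con 0ℚ ℚS.:* x) ℚS.:= x) refl (c 0) ⟩
  c 0                          ∎
  where
  open ≡-Reasoning
  c c′ : ℕ → ℚ
  c = invSqrtCoeff
  c′ = ∂ invSqrtCoeff
∂invSqrtCoeff-difference (suc m) = begin
  ι 2 * (c′ (suc m) - c′ m)                   ≡⟨ ℚP.*-distribˡ-+ (ι 2) (c′ (suc m)) (- c′ m) ⟩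
  ι 2 * c′ (suc m) + ι 2 * - c′ m             ≡⟨ cong (_+ ι 2 * - c′ m) (invSqrtCoeff-rec (suc m)) ⟩
  (c (suc m) + ι 2 * c′ m) + ι 2 * - c′ m
    ≡⟨ ℚS.solve 2 (λ x y → (x ℚS.:+ ℚS.con (ι 2) ℚS.:* y) ℚS.:+ ℚS.con (ι 2) ℚS.:* (ℚS.:- y) ℚS.:= x)
                  refl (c (suc m)) (c′ m) ⟩
  c (suc m)                                   ∎
  where
  open ≡-Reasoning
  c c′ : ℕ → ℚ
  c = invSqrtCoeff
  c′ = ∂ invSqrtCoeff

module _ (g : Series) (1-g-constantFree : ConstantFree (one ⊖ g)) where

  private
    t : Series
    t = one ⊖ g

  ⊗-compose-1-t : ∀ c → g ⊗ compose c t ≈ compose (λ n → c n - shift c n) t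
  ⊗-compose-1-t c = begin
    g ⊗ compose c t
      ≈⟨ solve (I 0F :* I 1F) (I 1F :- (K1 :- I 0F) :* I 1F) refl (g ∷ compose c t ∷ []) ⟩
    compose c t ⊖ t ⊗ compose c t
      ≈⟨ ⊕-cong (≈-refl {compose c t}) (neg-cong (⊗-compose-shift c t 1-g-constantFree)) ⟩
    compose c t ⊖ compose (shift c) t
      ≈⟨ ⊕-cong (≈-refl {compose c t}) (compose-neg (shift c) t) ⟩
    compose c t ⊕ compose (λ n → - shift c n) t
      ≈⟨ compose-⊕ c (λ n → - shift c n) t ⟩
    compose (λ n → c n - shift c n) t ∎
    where open ≈-Reasoning

  recipS≈compose : recipS g ≈ compose (λ _ → 1ℚ) t
  recipS≈compose = coeffwise λ a →
    trans (sumTo≡Σ< (deg a) (λ n → pow t n a)) (Σ<-congf (suc (deg a)) (λ n → sym (ℚP.*-identityˡ (pow t n a))))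

  invSqrtS≈compose : invSqrtS g ≈ compose invSqrtCoeff t
  invSqrtS≈compose = coeffwise λ a → sumTo≡Σ< (deg a) (λ n → invSqrtCoeff n * pow t n a)

  ⊗-recipS : g ⊗ recipS g ≈ one
  ⊗-recipS = begin
    g ⊗ recipS g                               ≈⟨ ⊗-congˡ {g} recipS≈compose ⟩
    g ⊗ compose (λ _ → 1ℚ) t                   ≈⟨ ⊗-compose-1-t (λ _ → 1ℚ) ⟩
    compose (λ n → 1ℚ - shift (λ _ → 1ℚ) n) t  ≈⟨ compose-cong _ δ₀ t coefficients ⟩
    compose δ₀ t                               ≈⟨ compose-δ₀ t ⟩
    one                                        ∎
    where
    open ≈-Reasoning
    coefficients : ∀ n → 1ℚ - shift (λ _ → 1ℚ) n ≡ δ₀ n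
    coefficients zero    = refl
    coefficients (suc n) = refl

  θ-⊗-recipS : ∀ j → θ j g ⊗ recipS g ⊕ g ⊗ θ j (recipS g) ≈ ⟦ K0 ⟧ᵥ
  θ-⊗-recipS j = ≈-trans (≈-sym (θ-⊗ j g (recipS g))) (≈-trans (θ-cong j ⊗-recipS) (θ-one j))

  θ-1-g : ∀ j → θ j t ≈ neg (θ j g)
  θ-1-g j = begin
    θ j t                     ≈⟨ θ-⊕ j one (neg g) ⟩
    θ j one ⊕ θ j (neg g)     ≈⟨ ⊕-cong (θ-one j) (θ-neg j g) ⟩
    ⟦ K0 ⟧ᵥ ⊕ neg (θ j g)     ≈⟨ solve (K0 :+ :- I 0F) (:- I 0F) refl (θ j g ∷ []) ⟩
    neg (θ j g)               ∎
    where open ≈-Reasoning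

  θ-invSqrtS : ∀ j → nat 2 ⊗ g ⊗ θ j (invSqrtS g) ≈ neg (θ j g) ⊗ invSqrtS g
  θ-invSqrtS j = begin
    nat 2 ⊗ g ⊗ θ j (invSqrtS g)
      ≈⟨ ⊗-congˡ {nat 2 ⊗ g} (θ-cong j invSqrtS≈compose) ⟩
    nat 2 ⊗ g ⊗ θ j (compose invSqrtCoeff t)
      ≈⟨ ⊗-congˡ {nat 2 ⊗ g} (θ-compose j invSqrtCoeff t 1-g-constantFree) ⟩
    nat 2 ⊗ g ⊗ (θ j t ⊗ compose c′ t)
      ≈⟨ solve (K2 :* I 0F :* (I 1F :* I 2F)) (I 1F :* (K2 :* (I 0F :* I 2F))) refl (g ∷ θ j t ∷ compose c′ t ∷ []) ⟩
    θ j t ⊗ (nat 2 ⊗ (g ⊗ compose c′ t))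
      ≈⟨ ⊗-cong (θ-1-g j) (≈-trans 2g⊗compose≈compose (≈-sym invSqrtS≈compose)) ⟩
    neg (θ j g) ⊗ invSqrtS g ∎
    where
    open ≈-Reasoning
    c′ : ℕ → ℚ
    c′ = ∂ invSqrtCoeff
    2g⊗compose≈compose : nat 2 ⊗ (g ⊗ compose c′ t) ≈ compose invSqrtCoeff t
    2g⊗compose≈compose = begin
      nat 2 ⊗ (g ⊗ compose c′ t)                      ≈⟨ ⊗-congˡ {nat 2} (⊗-compose-1-t c′) ⟩
      nat 2 ⊗ compose (λ n → c′ n - shift c′ n) t     ≈⟨ const-⊗-compose (ι 2) (λ n → c′ n - shift c′ n) t ⟩
      compose (λ n → ι 2 * (c′ n - shift c′ n)) t     ≈⟨ compose-cong _ invSqrtCoeff t ∂invSqrtCoeff-difference ⟩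
      compose invSqrtCoeff t                          ∎

θ-expS : ∀ j f → ConstantFree f → θ j (expS f) ≈ θ j f ⊗ expS f
θ-expS j f f-constantFree = begin
  θ j (expS f)                     ≈⟨ θ-cong j expS≈compose ⟩
  θ j (compose expCoeff f)         ≈⟨ θ-compose j expCoeff f f-constantFree ⟩
  θ j f ⊗ compose (∂ expCoeff) f   ≈⟨ ⊗-congˡ {θ j f} (compose-cong _ expCoeff f expCoeff-rec) ⟩
  θ j f ⊗ compose expCoeff f       ≈⟨ ⊗-congˡ {θ j f} (≈-sym expS≈compose) ⟩
  θ j f ⊗ expS f                   ∎
  where
  open ≈-Reasoning
  expS≈compose : expS f ≈ compose expCoeff f
  expS≈compose = coeffwise λ a → sumTo≡Σ< (deg a) (λ n → expCoeff n * pow f n a)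

-- The differential equation of D^(-1/2) exp(N/D)

module _ (D : Series) (1-D-constantFree : ConstantFree (one ⊖ D)) where

  2D²-cancel : ∀ F G → nat 2 ⊗ D ⊗ D ⊗ F ≈ nat 2 ⊗ D ⊗ D ⊗ G → F ≈ G
  2D²-cancel F G 2D²F≈2D²G = begin
    F                                 ≈⟨ ≈-sym (≈-trans (⊗-congʳ {g = F} inverse) (⊗-identityˡ F)) ⟩
    (D⁻²/2 ⊗ (nat 2 ⊗ D ⊗ D)) ⊗ F     ≈⟨ ⊗-assoc D⁻²/2 (nat 2 ⊗ D ⊗ D) F ⟩
    D⁻²/2 ⊗ (nat 2 ⊗ D ⊗ D ⊗ F)       ≈⟨ ⊗-congˡ {D⁻²/2} 2D²F≈2D²G ⟩
    D⁻²/2 ⊗ (nat 2 ⊗ D ⊗ D ⊗ G)       ≈⟨ ≈-sym (⊗-assoc D⁻²/2 (nat 2 ⊗ D ⊗ D) G) ⟩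
    (D⁻²/2 ⊗ (nat 2 ⊗ D ⊗ D)) ⊗ G     ≈⟨ ≈-trans (⊗-congʳ {g = G} inverse) (⊗-identityˡ G) ⟩
    G                                 ∎
    where
    open ≈-Reasoning
    half D⁻²/2 : Series
    half = const (ℤ.+ 1 / 2)
    D⁻²/2 = half ⊗ recipS D ⊗ recipS D
    inverse : D⁻²/2 ⊗ (nat 2 ⊗ D ⊗ D) ≈ one
    inverse = solve-modulo {ρ = half ∷ D ∷ recipS D ∷ []} ((h :* q :* q) :* (K2 :* d :* d)) K1
      ( ((q :* q :* d :* d , h :* K2 , K1) , ≈-sym (const-* (ℤ.+ 1 / 2) (ιℤ (ℤ.+ 2))))
      ∷ ((q :* d :+ K1 , d :* q , K1) , ⊗-recipS D 1-D-constantFree)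
      ∷ []) refl
      where
      h d q : Expr 3
      h = I (# 0)
      d = I (# 1)
      q = I (# 2)

  module _ (N : Series) (N-constantFree : ConstantFree N) where

    -- θR = θS·E + S·θE with 2D·θS = -θD·S, θE = θg·E, θg = θN·Q + N·θQ, DQ = 1 and θD·Q + D·θQ = 0,
    -- where S = D^(-1/2), Q = 1/D, g = N Q and E = exp g.
    θ-invSqrt⊗exp : ∀ j → let R = invSqrtS D ⊗ expS (N ⊗ recipS D) in
      nat 2 ⊗ D ⊗ D ⊗ θ j R ≈ R ⊗ (neg (θ j D) ⊗ D ⊕ nat 2 ⊗ θ j N ⊗ D ⊖ nat 2 ⊗ N ⊗ θ j D)
    θ-invSqrt⊗exp j = begin
      nat 2 ⊗ D ⊗ D ⊗ θ j (S ⊗ E)                  ≈⟨ ⊗-congˡ {nat 2 ⊗ D ⊗ D} (θ-⊗ j S E) ⟩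
      nat 2 ⊗ D ⊗ D ⊗ (θ j S ⊗ E ⊕ S ⊗ θ j E)      ≈⟨ solve-modulo lhs rhs certificate refl ⟩
      S ⊗ E ⊗ (neg (θ j D) ⊗ D ⊕ nat 2 ⊗ θ j N ⊗ D ⊖ nat 2 ⊗ N ⊗ θ j D) ∎
      where
      open ≈-Reasoning
      Q S g E : Series
      Q = recipS D
      S = invSqrtS D
      g = N ⊗ Q
      E = expS g
      ρ : Vec Series 11
      ρ = D ∷ Q ∷ S ∷ E ∷ θ j S ∷ θ j Q ∷ θ j D ∷ θ j N ∷ N ∷ θ j E ∷ θ j g ∷ []
      d q s e θs θq θd θn n θe θg : Expr 11
      d  = I (# 0)
      q  = I (# 1)
      s  = I (# 2)
      e  = I (# 3)
      θs = I (# 4)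
      θq = I (# 5)
      θd = I (# 6)
      θn = I (# 7)
      n  = I (# 8)
      θe = I (# 9)
      θg = I (# 10)
      lhs rhs : Expr 11
      lhs = K2 :* d :* d :* (θs :* e :+ s :* θe)
      rhs = s :* e :* (:- θd :* d :+ K2 :* θn :* d :- K2 :* n :* θd)
      certificate : List (Hypothesis ρ)
      certificate = ((d :* e , K2 :* d :* θs , :- θd :* s) , θ-invSqrtS D 1-D-constantFree j)
                  ∷ ((K2 :* d :* s :* e :* θn :- K2 :* s :* e :* n :* θd , d :* q , K1) , ⊗-recipS D 1-D-constantFree)
                  ∷ ((K2 :* d :* s :* e :* n , θd :* q :+ d :* θq , K0) , θ-⊗-recipS D 1-D-constantFree j)
                  ∷ ((K2 :* d :* d :* s , θe , θg :* e) , θ-expS j g (⊗-constantFree N Q N-constantFree))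
                  ∷ ((K2 :* d :* d :* s :* e , θg , θn :* q :+ n :* θq) , θ-⊗ j N Q)
                  ∷ []

:u :v :w :x :y :z : Expr 6
:u = I 0F
:v = I 1F
:w = I 2F
:x = I 3F
:y = I 4F
:z = I 5F

-- e :* (e :* K1) mirrors pow e 2 = e ⊗ (e ⊗ one), so ⟦ Denₑ ⟧ᵥ and ⟦ Numₑ ⟧ᵥ are Den and Num by definition.
square : ∀ {n} → Expr n → Expr n
square e = e :* (e :* K1)

Denₑ Numₑ Aₑ : Expr 6
Denₑ = square (K1 :- :u :* :z) :- K (ℤ.+ 4) :* square :u :* :x :* :y
Numₑ = square (K1 :+ :u :* :w) :* :x :+ square (K1 :+ :u :* :v) :* :y :+ K (ℤ.+ 4) :* :u :* :x :* :y
     :+ (K1 :- :u :* :z) :* (:v :+ :w :+ :z :+ :u :* :v :* :w)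
Aₑ = K2 :* Denₑ :* Denₑ

Pₑ[_,_] : Expr 6 → Expr 6 → Expr 6
Pₑ[ θD , θN ] = :- θD :* Denₑ :+ K2 :* θN :* Denₑ :- K2 :* Numₑ :* θD

Pₑ : Fin 6 → Expr 6
Pₑ j = Pₑ[ θₑ j Denₑ , θₑ j Numₑ ]

R : Series
R = RHS

R-euler : ∀ j → ⟦ Aₑ ⟧ᵥ ⊗ θ j R ≈ R ⊗ ⟦ Pₑ j ⟧ᵥ
R-euler j = ≈-trans (θ-invSqrt⊗exp Den refl Num refl j) (⊗-congˡ {R} (⟦⟧-cong template {ρ} {ρ′} θ≈θₑ))
  where
  template : Expr 4
  template = :- I (# 0) :* I (# 1) :+ K2 :* I (# 2) :* I (# 1) :- K2 :* I (# 3) :* I (# 0)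
  ρ ρ′ : Vec Series 4
  ρ  = θ j Den ∷ Den ∷ θ j Num ∷ Num ∷ []
  ρ′ = ⟦ θₑ j Denₑ ⟧ᵥ ∷ Den ∷ ⟦ θₑ j Numₑ ⟧ᵥ ∷ Num ∷ []
  θ≈θₑ : ∀ i → lookup ρ i ≈ lookup ρ′ i
  θ≈θₑ 0F = θₑ-correct j Denₑ
  θ≈θₑ 1F = ≈-refl
  θ≈θₑ 2F = θₑ-correct j Numₑ
  θ≈θₑ 3F = ≈-refl

R-euler-θ : ∀ j k →
  ⟦ θₑ j Aₑ ⟧ᵥ ⊗ θ k R ⊕ ⟦ Aₑ ⟧ᵥ ⊗ θ j (θ k R) ≈ θ j R ⊗ ⟦ Pₑ k ⟧ᵥ ⊕ R ⊗ ⟦ θₑ j (Pₑ k) ⟧ᵥ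
R-euler-θ j k = begin
  ⟦ θₑ j Aₑ ⟧ᵥ ⊗ θ k R ⊕ ⟦ Aₑ ⟧ᵥ ⊗ θ j (θ k R)
    ≈⟨ ⊕-cong (⊗-congʳ {g = θ k R} (≈-sym (θₑ-correct j Aₑ))) (≈-refl {⟦ Aₑ ⟧ᵥ ⊗ θ j (θ k R)}) ⟩
  θ j ⟦ Aₑ ⟧ᵥ ⊗ θ k R ⊕ ⟦ Aₑ ⟧ᵥ ⊗ θ j (θ k R)
    ≈⟨ ≈-sym (θ-⊗ j ⟦ Aₑ ⟧ᵥ (θ k R)) ⟩
  θ j (⟦ Aₑ ⟧ᵥ ⊗ θ k R)                         ≈⟨ θ-cong j (R-euler k) ⟩
  θ j (R ⊗ ⟦ Pₑ k ⟧ᵥ)                           ≈⟨ θ-⊗ j R ⟦ Pₑ k ⟧ᵥ ⟩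
  θ j R ⊗ ⟦ Pₑ k ⟧ᵥ ⊕ R ⊗ θ j ⟦ Pₑ k ⟧ᵥ
    ≈⟨ ⊕-cong (≈-refl {θ j R ⊗ ⟦ Pₑ k ⟧ᵥ}) (⊗-congˡ {R} (θₑ-correct j (Pₑ k))) ⟩
  θ j R ⊗ ⟦ Pₑ k ⟧ᵥ ⊕ R ⊗ ⟦ θₑ j (Pₑ k) ⟧ᵥ ∎
  where open ≈-Reasoning

weaken : ∀ k → Expr 6 → Expr (6 ℕ.+ k)
weaken k (K z)     = K z
weaken k (I i)     = I (i Fin.↑ˡ k)
weaken k (e :+ e′) = weaken k e :+ weaken k e′
weaken k (e :* e′) = weaken k e :* weaken k e′
weaken k (:- e)    = :- weaken k e

⟦weaken⟧ : ∀ k e (ρ : Vec Series k) → ⟦ weaken k e ⟧ (vars ++ᵛ ρ) ≈ ⟦ e ⟧ᵥ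
⟦weaken⟧ k (K z)     ρ = ≈-refl
⟦weaken⟧ k (I i)     ρ = coeffwise (λ a → cong (λ f → f a) (VecP.lookup-++ˡ vars ρ i))
⟦weaken⟧ k (e :+ e′) ρ = ⊕-cong (⟦weaken⟧ k e ρ) (⟦weaken⟧ k e′ ρ)
⟦weaken⟧ k (e :* e′) ρ = ⊗-cong (⟦weaken⟧ k e ρ) (⟦weaken⟧ k e′ ρ)
⟦weaken⟧ k (:- e)    ρ = neg-cong (⟦weaken⟧ k e ρ)

derivatives : Vec Series 10
derivatives = R ∷ θ 0F R ∷ θ 1F R ∷ θ 2F R ∷ θ 3F R ∷ θ 4F R ∷ θ 5F R
            ∷ θ 1F (θ 1F R) ∷ θ 2F (θ 2F R) ∷ θ 1F (θ 2F R) ∷ []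

env : Vec Series 16
env = vars ++ᵛ derivatives

↑ : Expr 6 → Expr 16
↑ = weaken 10

r θvvr θwwr θvwr : Expr 16
r    = I (# 6)
θvvr = I (# 13)
θwwr = I (# 14)
θvwr = I (# 15)

θr : Fin 6 → Expr 16
θr j = I (7 Fin.↑ʳ (j Fin.↑ˡ 3))

lookup-θr : ∀ j → ⟦ θr j ⟧ env ≈ θ j R
lookup-θr 0F = ≈-refl
lookup-θr 1F = ≈-refl
lookup-θr 2F = ≈-refl
lookup-θr 3F = ≈-refl
lookup-θr 4F = ≈-refl
lookup-θr 5F = ≈-refl

euler : Expr 16 → Fin 6 → Hypothesis env
euler c k = (c , ↑ Aₑ :* θr k , r :* ↑ (Pₑ k)) , (begin
  ⟦ ↑ Aₑ ⟧ env ⊗ ⟦ θr k ⟧ env   ≈⟨ ⊗-cong (⟦weaken⟧ 10 Aₑ derivatives) (lookup-θr k) ⟩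
  ⟦ Aₑ ⟧ᵥ ⊗ θ k R               ≈⟨ R-euler k ⟩
  R ⊗ ⟦ Pₑ k ⟧ᵥ                 ≈⟨ ⊗-congˡ {R} (≈-sym (⟦weaken⟧ 10 (Pₑ k) derivatives)) ⟩
  R ⊗ ⟦ ↑ (Pₑ k) ⟧ env          ∎)
  where open ≈-Reasoning

euler-θ : Expr 16 → ∀ j k θjθkr → ⟦ θjθkr ⟧ env ≈ θ j (θ k R) → Hypothesis env
euler-θ c j k θjθkr θjθkr≈ =
  (c , ↑ (θₑ j Aₑ) :* θr k :+ ↑ Aₑ :* θjθkr , θr j :* ↑ (Pₑ k) :+ r :* ↑ (θₑ j (Pₑ k))) , (begin
  ⟦ ↑ (θₑ j Aₑ) :* θr k :+ ↑ Aₑ :* θjθkr ⟧ env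
    ≈⟨ ⊕-cong (⊗-cong (⟦weaken⟧ 10 (θₑ j Aₑ) derivatives) (lookup-θr k))
              (⊗-cong (⟦weaken⟧ 10 Aₑ derivatives) θjθkr≈) ⟩
  ⟦ θₑ j Aₑ ⟧ᵥ ⊗ θ k R ⊕ ⟦ Aₑ ⟧ᵥ ⊗ θ j (θ k R)
    ≈⟨ R-euler-θ j k ⟩
  θ j R ⊗ ⟦ Pₑ k ⟧ᵥ ⊕ R ⊗ ⟦ θₑ j (Pₑ k) ⟧ᵥ
    ≈⟨ ≈-sym (⊕-cong (⊗-cong (lookup-θr j) (⟦weaken⟧ 10 (Pₑ k) derivatives))
                     (⊗-congˡ {R} (⟦weaken⟧ 10 (θₑ j (Pₑ k)) derivatives))) ⟩
  ⟦ θr j :* ↑ (Pₑ k) :+ r :* ↑ (θₑ j (Pₑ k)) ⟧ env ∎)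
  where open ≈-Reasoning

2D²-cancel² : ∀ F G → ⟦ Aₑ ⟧ᵥ ⊗ ⟦ Aₑ ⟧ᵥ ⊗ F ≈ ⟦ Aₑ ⟧ᵥ ⊗ ⟦ Aₑ ⟧ᵥ ⊗ G → F ≈ G
2D²-cancel² F G A²F≈A²G = 2D²-cancel Den refl F G (2D²-cancel Den refl (⟦ Aₑ ⟧ᵥ ⊗ F) (⟦ Aₑ ⟧ᵥ ⊗ G)
  (≈-trans (≈-sym (⊗-assoc ⟦ Aₑ ⟧ᵥ ⟦ Aₑ ⟧ᵥ F)) (≈-trans A²F≈A²G (⊗-assoc ⟦ Aₑ ⟧ᵥ ⟦ Aₑ ⟧ᵥ G))))

-- Each identity is A · (lhs - rhs) = Σ cₖ (A θₖ R - R Pₖ) (and its θ-derivatives) as polynomials,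
-- followed by cancelling A = 2D².
R-θv : θ 1F R ≈ V ⊗ (R ⊕ U ⊗ (θ 2F R ⊕ nat 2 ⊗ θ 4F R ⊕ θ 5F R ⊖ θ 0F R))
R-θv = 2D²-cancel Den refl _ _ (solve-modulo
  (↑ Aₑ :* θr 1F) (↑ Aₑ :* (↑ :v :* (r :+ ↑ :u :* (θr 2F :+ K2 :* θr 4F :+ θr 5F :- θr 0F))))
  (euler K1 1F ∷ euler (:- (↑ :v :* ↑ :u)) 2F ∷ euler (:- (K2 :* ↑ :v :* ↑ :u)) 4F
    ∷ euler (:- (↑ :v :* ↑ :u)) 5F ∷ euler (↑ :v :* ↑ :u) 0F ∷ [])
  refl)

R-θw : θ 2F R ≈ W ⊗ (R ⊕ U ⊗ (θ 1F R ⊕ nat 2 ⊗ θ 3F R ⊕ θ 5F R ⊖ θ 0F R))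
R-θw = 2D²-cancel Den refl _ _ (solve-modulo
  (↑ Aₑ :* θr 2F) (↑ Aₑ :* (↑ :w :* (r :+ ↑ :u :* (θr 1F :+ K2 :* θr 3F :+ θr 5F :- θr 0F))))
  (euler K1 2F ∷ euler (:- (↑ :w :* ↑ :u)) 1F ∷ euler (:- (K2 :* ↑ :w :* ↑ :u)) 3F
    ∷ euler (:- (↑ :w :* ↑ :u)) 5F ∷ euler (↑ :w :* ↑ :u) 0F ∷ [])
  refl)

R-θx : V ⊗ (V ⊗ θ 3F R) ≈ X ⊗ (θ 1F (θ 1F R) ⊖ θ 1F R)
R-θx = 2D²-cancel² _ _ (solve-modulo
  (↑ Aₑ :* ↑ Aₑ :* (↑ :v :* (↑ :v :* θr 3F))) (↑ Aₑ :* ↑ Aₑ :* (↑ :x :* (θvvr :- θr 1F)))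
  (euler (↑ Aₑ :* ↑ :v :* ↑ :v) 3F ∷ euler-θ (:- (↑ Aₑ :* ↑ :x)) 1F 1F θvvr ≈-refl
    ∷ euler (↑ Aₑ :* ↑ :x :- ↑ :x :* (↑ (Pₑ 1F) :- ↑ (θₑ 1F Aₑ))) 1F ∷ [])
  refl)

R-θy : W ⊗ (W ⊗ θ 4F R) ≈ Y ⊗ (θ 2F (θ 2F R) ⊖ θ 2F R)
R-θy = 2D²-cancel² _ _ (solve-modulo
  (↑ Aₑ :* ↑ Aₑ :* (↑ :w :* (↑ :w :* θr 4F))) (↑ Aₑ :* ↑ Aₑ :* (↑ :y :* (θwwr :- θr 2F)))
  (euler (↑ Aₑ :* ↑ :w :* ↑ :w) 4F ∷ euler-θ (:- (↑ Aₑ :* ↑ :y)) 2F 2F θwwr ≈-refl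
    ∷ euler (↑ Aₑ :* ↑ :y :- ↑ :y :* (↑ (Pₑ 2F) :- ↑ (θₑ 2F Aₑ))) 2F ∷ [])
  refl)

R-θz : V ⊗ (W ⊗ θ 5F R) ≈ Z ⊗ θ 1F (θ 2F R)
R-θz = 2D²-cancel² _ _ (solve-modulo
  (↑ Aₑ :* ↑ Aₑ :* (↑ :v :* (↑ :w :* θr 5F))) (↑ Aₑ :* ↑ Aₑ :* (↑ :z :* θvwr))
  (euler (↑ Aₑ :* ↑ :v :* ↑ :w) 5F ∷ euler-θ (:- (↑ Aₑ :* ↑ :z)) 1F 2F θvwr ≈-refl
    ∷ euler (↑ :z :* ↑ (θₑ 1F Aₑ)) 2F ∷ euler (:- (↑ :z :* ↑ (Pₑ 2F))) 1F ∷ [])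
  refl)

-- Coefficient recurrences

mono : ℕ → ℕ → ℕ → ℕ → ℕ → ℕ → Mono
mono p i j k l m = p ∷ i ∷ j ∷ k ∷ l ∷ m ∷ []

pure-u : ℕ → Mono
pure-u p = mono p 0 0 0 0 0

-- The coefficient of v^i w^j x^k y^l z^m on the left involves H (weight i k m) (weight j l m).
weight : ℕ → ℕ → ℕ → ℕ
weight i k m = i ℕ.+ 2 ℕ.* k ℕ.+ m

uCorrection : (Mono → ℚ) → ℕ → ℕ → ℕ → ℕ → ℕ → ℕ → ℕ → ℚ
uCorrection F n zero    i j k l m = 0ℚ
uCorrection F n (suc q) i j k l m = (ι n - ι q) * F (mono q i j k l m)

RecV RecW RecX RecY RecZ Base : (Mono → ℚ) → Set
RecV F = ∀ p i j k l m →
  ι (suc i) * F (mono p (suc i) j k l m) ≡ F (mono p i j k l m) + uCorrection F (weight j l m) p i j k l m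
RecW F = ∀ p i j k l m →
  ι (suc j) * F (mono p i (suc j) k l m) ≡ F (mono p i j k l m) + uCorrection F (weight i k m) p i j k l m
RecX F = ∀ p i j k l m →
  ι (suc k) * F (mono p i j (suc k) l m) ≡ ι ((2 ℕ.+ i) ℕ.* suc i) * F (mono p (2 ℕ.+ i) j k l m)
RecY F = ∀ p i j k l m →
  ι (suc l) * F (mono p i j k (suc l) m) ≡ ι ((2 ℕ.+ j) ℕ.* suc j) * F (mono p i (2 ℕ.+ j) k l m)
RecZ F = ∀ p i j k l m →
  ι (suc m) * F (mono p i j k l (suc m)) ≡ ι (suc i) * (ι (suc j) * F (mono p (suc i) (suc j) k l m))
Base F = ∀ p → F (pure-u p) ≡ δ₀ p

record Recurrences (F : Mono → ℚ) : Set where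
  field
    rec-v : RecV F
    rec-w : RecW F
    rec-x : RecX F
    rec-y : RecY F
    rec-z : RecZ F
    base  : Base F

ι-weight : ∀ i k m → ι (weight i k m) ≡ ι i + ι 2 * ι k + ι m
ι-weight i k m =
  trans (ι-+ (i ℕ.+ 2 ℕ.* k) m) (cong (_+ ι m) (trans (ι-+ i (2 ℕ.* k)) (cong (ι i +_) (ι-* 2 k))))

weight-factor : ∀ i k m q x →
  ((ι i * x + ι 2 * (ι k * x)) + ι m * x) + - (ι q * x) ≡ (ι (weight i k m) - ι q) * x
weight-factor i k m q x = trans
  (ℚS.solve 6 (λ i t k m q x → ((i ℚS.:* x ℚS.:+ t ℚS.:* (k ℚS.:* x)) ℚS.:+ m ℚS.:* x) ℚS.:+ ℚS.:- (q ℚS.:* x)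
                                ℚS.:= (i ℚS.:+ t ℚS.:* k ℚS.:+ m ℚS.:+ ℚS.:- q) ℚS.:* x)
              refl (ι i) (ι 2) (ι k) (ι m) (ι q) x)
  (cong (λ w → (w - ι q) * x) (sym (ι-weight i k m)))

[2+i]²-[2+i] : ∀ i x → ι (2 ℕ.+ i) * (ι (2 ℕ.+ i) * x) + - (ι (2 ℕ.+ i) * x) ≡ ι ((2 ℕ.+ i) ℕ.* suc i) * x
[2+i]²-[2+i] i x = begin
  ι (2 ℕ.+ i) * (ι (2 ℕ.+ i) * x) + - (ι (2 ℕ.+ i) * x)
    ≡⟨ cong (λ t → t * (t * x) + - (t * x)) (ι-suc (suc i)) ⟩
  (1ℚ + ι (suc i)) * ((1ℚ + ι (suc i)) * x) + - ((1ℚ + ι (suc i)) * x)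
    ≡⟨ ℚS.solve 2 (λ s x → (ℚS.con 1ℚ ℚS.:+ s) ℚS.:* ((ℚS.con 1ℚ ℚS.:+ s) ℚS.:* x)
                             ℚS.:+ ℚS.:- ((ℚS.con 1ℚ ℚS.:+ s) ℚS.:* x)
                           ℚS.:= ((ℚS.con 1ℚ ℚS.:+ s) ℚS.:* s) ℚS.:* x) refl (ι (suc i)) x ⟩
  ((1ℚ + ι (suc i)) * ι (suc i)) * x
    ≡⟨ cong (_* x) (trans (cong (_* ι (suc i)) (sym (ι-suc (suc i)))) (sym (ι-* (2 ℕ.+ i) (suc i)))) ⟩
  ι ((2 ℕ.+ i) ℕ.* suc i) * x ∎
  where open ≡-Reasoning

R-rec-v : RecV R
R-rec-v p i j k l m = trans (coeff R-θv (mono p (suc i) j k l m))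
  (trans (var-⊗ 1F (R ⊕ U ⊗ H) (mono p (suc i) j k l m)) (cong (R (mono p i j k l m) +_) (u-term p)))
  where
  H : Series
  H = θ 2F R ⊕ nat 2 ⊗ θ 4F R ⊕ θ 5F R ⊖ θ 0F R
  u-term : ∀ p → (U ⊗ H) (mono p i j k l m) ≡ uCorrection R (weight j l m) p i j k l m
  u-term zero    = var-⊗ 0F H (mono 0 i j k l m)
  u-term (suc q) = trans (var-⊗ 0F H (mono (suc q) i j k l m))
    (trans (cong (λ t → ((ι j * R b + t) + ι m * R b) + - (ι q * R b)) (const-⊗ (ι 2) (θ 4F R) b))
           (weight-factor j l m q (R b)))
    where
    b : Mono
    b = mono q i j k l m

R-rec-w : RecW R
R-rec-w p i j k l m = trans (coeff R-θw (mono p i (suc j) k l m))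
  (trans (var-⊗ 2F (R ⊕ U ⊗ H) (mono p i (suc j) k l m)) (cong (R (mono p i j k l m) +_) (u-term p)))
  where
  H : Series
  H = θ 1F R ⊕ nat 2 ⊗ θ 3F R ⊕ θ 5F R ⊖ θ 0F R
  u-term : ∀ p → (U ⊗ H) (mono p i j k l m) ≡ uCorrection R (weight i k m) p i j k l m
  u-term zero    = var-⊗ 0F H (mono 0 i j k l m)
  u-term (suc q) = trans (var-⊗ 0F H (mono (suc q) i j k l m))
    (trans (cong (λ t → ((ι i * R b + t) + ι m * R b) + - (ι q * R b)) (const-⊗ (ι 2) (θ 3F R) b))
           (weight-factor i k m q (R b)))
    where
    b : Mono
    b = mono q i j k l m

R-rec-x : RecX R
R-rec-x p i j k l m = begin
  ι (suc k) * R (mono p i j (suc k) l m)               ≡⟨ sym (var-⊗ 1F (θ 3F R) (mono p (suc i) j (suc k) l m)) ⟩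
  (V ⊗ θ 3F R) (mono p (suc i) j (suc k) l m)          ≡⟨ sym (var-⊗ 1F (V ⊗ θ 3F R) a) ⟩
  (V ⊗ (V ⊗ θ 3F R)) a                                 ≡⟨ coeff R-θx a ⟩
  (X ⊗ (θ 1F (θ 1F R) ⊖ θ 1F R)) a                     ≡⟨ var-⊗ 3F (θ 1F (θ 1F R) ⊖ θ 1F R) a ⟩
  ι (2 ℕ.+ i) * (ι (2 ℕ.+ i) * R b) + - (ι (2 ℕ.+ i) * R b) ≡⟨ [2+i]²-[2+i] i (R b) ⟩
  ι ((2 ℕ.+ i) ℕ.* suc i) * R b                        ∎
  where
  open ≡-Reasoning
  a b : Mono
  a = mono p (2 ℕ.+ i) j (suc k) l m
  b = mono p (2 ℕ.+ i) j k l m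

R-rec-y : RecY R
R-rec-y p i j k l m = begin
  ι (suc l) * R (mono p i j k (suc l) m)               ≡⟨ sym (var-⊗ 2F (θ 4F R) (mono p i (suc j) k (suc l) m)) ⟩
  (W ⊗ θ 4F R) (mono p i (suc j) k (suc l) m)          ≡⟨ sym (var-⊗ 2F (W ⊗ θ 4F R) a) ⟩
  (W ⊗ (W ⊗ θ 4F R)) a                                 ≡⟨ coeff R-θy a ⟩
  (Y ⊗ (θ 2F (θ 2F R) ⊖ θ 2F R)) a                     ≡⟨ var-⊗ 4F (θ 2F (θ 2F R) ⊖ θ 2F R) a ⟩
  ι (2 ℕ.+ j) * (ι (2 ℕ.+ j) * R b) + - (ι (2 ℕ.+ j) * R b) ≡⟨ [2+i]²-[2+i] j (R b) ⟩
  ι ((2 ℕ.+ j) ℕ.* suc j) * R b                        ∎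
  where
  open ≡-Reasoning
  a b : Mono
  a = mono p i (2 ℕ.+ j) k (suc l) m
  b = mono p i (2 ℕ.+ j) k l m

R-rec-z : RecZ R
R-rec-z p i j k l m = begin
  ι (suc m) * R (mono p i j k l (suc m))               ≡⟨ sym (var-⊗ 2F (θ 5F R) (mono p i (suc j) k l (suc m))) ⟩
  (W ⊗ θ 5F R) (mono p i (suc j) k l (suc m))          ≡⟨ sym (var-⊗ 1F (W ⊗ θ 5F R) a) ⟩
  (V ⊗ (W ⊗ θ 5F R)) a                                 ≡⟨ coeff R-θz a ⟩
  (Z ⊗ θ 1F (θ 2F R)) a                                ≡⟨ var-⊗ 5F (θ 1F (θ 2F R)) a ⟩
  ι (suc i) * (ι (suc j) * R (mono p (suc i) (suc j) k l m)) ∎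
  where
  open ≡-Reasoning
  a : Mono
  a = mono p (suc i) (suc j) k l (suc m)

-- On pure powers of u, A = 2D² acts as 2 and P_u as 0: D = 1 + z dz + x dx, and θ_u D, θ_u N lie in (v, x, y, z).
dz dx θuD-z θuD-x θuN-x θuN-y θuN-z θuN-v : Expr 6
dz    = :u :* (:u :* :z :- K2)
dx    = :- (K (ℤ.+ 4) :* :u :* :u :* :y)
θuD-z = :- (K2 :* :u :* (K1 :- :u :* :z))
θuD-x = :- (K (ℤ.+ 8) :* :u :* :u :* :y)
θuN-x = K2 :* :u :* :w :* (K1 :+ :u :* :w) :+ K (ℤ.+ 4) :* :u :* :y
θuN-y = K2 :* :u :* :v :* (K1 :+ :u :* :v)
θuN-z = :- (:u :* (:v :+ :w :+ :z :+ :u :* :v :* :w))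
θuN-v = (K1 :- :u :* :z) :* :u :* :w

Aₑ-z Aₑ-x : Expr 6
Aₑ-z = K2 :* dz :* (Denₑ :+ K1)
Aₑ-x = K2 :* dx :* (Denₑ :+ K1)

Aₑ-decomposition : ⟦ Aₑ ⟧ᵥ ≈ ⟦ K2 :+ :z :* Aₑ-z :+ :x :* Aₑ-x ⟧ᵥ
Aₑ-decomposition = solve Aₑ (K2 :+ :z :* Aₑ-z :+ :x :* Aₑ-x) refl vars

Pₑu-x Pₑu-y Pₑu-z Pₑu-v : Expr 6
Pₑu-x = Pₑ[ θuD-x , θuN-x ]
Pₑu-y = Pₑ[ K0 , θuN-y ]
Pₑu-z = Pₑ[ θuD-z , θuN-z ]
Pₑu-v = Pₑ[ K0 , θuN-v ]

Pₑu-decomposition : ⟦ Pₑ 0F ⟧ᵥ ≈ ⟦ :x :* Pₑu-x :+ :y :* Pₑu-y :+ :z :* Pₑu-z :+ :v :* Pₑu-v ⟧ᵥ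
Pₑu-decomposition = solve (Pₑ 0F) (:x :* Pₑu-x :+ :y :* Pₑu-y :+ :z :* Pₑu-z :+ :v :* Pₑu-v) refl vars

A⊗θuR-pure-u : ∀ p → (⟦ Aₑ ⟧ᵥ ⊗ θ 0F R) (pure-u p) ≡ ι 2 * (ι p * R (pure-u p))
A⊗θuR-pure-u p = begin
  (⟦ Aₑ ⟧ᵥ ⊗ θ 0F R) a
    ≡⟨ coeff (⊗-congʳ {g = θ 0F R} Aₑ-decomposition) a ⟩
  (⟦ K2 :+ :z :* Aₑ-z :+ :x :* Aₑ-x ⟧ᵥ ⊗ θ 0F R) a
    ≡⟨ coeff (solve ((K2 :+ I (# 0) :* I (# 2) :+ I (# 1) :* I (# 3)) :* I (# 4))
                    (K2 :* I (# 4) :+ I (# 0) :* (I (# 2) :* I (# 4)) :+ I (# 1) :* (I (# 3) :* I (# 4))) refl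
                    (Z ∷ X ∷ A-z ∷ A-x ∷ θ 0F R ∷ [])) a ⟩
  (nat 2 ⊗ θ 0F R) a + (Z ⊗ (A-z ⊗ θ 0F R)) a + (X ⊗ (A-x ⊗ θ 0F R)) a
    ≡⟨ cong₂ (λ s t → (nat 2 ⊗ θ 0F R) a + s + t) (var-⊗ 5F (A-z ⊗ θ 0F R) a) (var-⊗ 3F (A-x ⊗ θ 0F R) a) ⟩
  (nat 2 ⊗ θ 0F R) a + 0ℚ + 0ℚ
    ≡⟨ trans (ℚP.+-identityʳ _) (ℚP.+-identityʳ ((nat 2 ⊗ θ 0F R) a)) ⟩
  (nat 2 ⊗ θ 0F R) a
    ≡⟨ const-⊗ (ι 2) (θ 0F R) a ⟩
  ι 2 * (ι p * R a) ∎
  where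
  open ≡-Reasoning
  a : Mono
  a = pure-u p
  A-z A-x : Series
  A-z = ⟦ Aₑ-z ⟧ᵥ
  A-x = ⟦ Aₑ-x ⟧ᵥ

R⊗Pu-pure-u : ∀ p → (R ⊗ ⟦ Pₑ 0F ⟧ᵥ) (pure-u p) ≡ 0ℚ
R⊗Pu-pure-u p = begin
  (R ⊗ ⟦ Pₑ 0F ⟧ᵥ) a
    ≡⟨ coeff (⊗-congˡ {R} Pₑu-decomposition) a ⟩
  (R ⊗ ⟦ :x :* Pₑu-x :+ :y :* Pₑu-y :+ :z :* Pₑu-z :+ :v :* Pₑu-v ⟧ᵥ) a
    ≡⟨ coeff (solve (I (# 8) :* (I (# 0) :* I (# 4) :+ I (# 1) :* I (# 5) :+ I (# 2) :* I (# 6) :+ I (# 3) :* I (# 7)))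
                    (I (# 0) :* (I (# 4) :* I (# 8)) :+ I (# 1) :* (I (# 5) :* I (# 8))
                      :+ I (# 2) :* (I (# 6) :* I (# 8)) :+ I (# 3) :* (I (# 7) :* I (# 8))) refl
                    (X ∷ Y ∷ Z ∷ V ∷ P-x ∷ P-y ∷ P-z ∷ P-v ∷ R ∷ [])) a ⟩
  (X ⊗ (P-x ⊗ R)) a + (Y ⊗ (P-y ⊗ R)) a + (Z ⊗ (P-z ⊗ R)) a + (V ⊗ (P-v ⊗ R)) a
    ≡⟨ cong₂ _+_ (cong₂ _+_ (cong₂ _+_ (var-⊗ 3F (P-x ⊗ R) a) (var-⊗ 4F (P-y ⊗ R) a)) (var-⊗ 5F (P-z ⊗ R) a))
                 (var-⊗ 1F (P-v ⊗ R) a) ⟩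
  0ℚ ∎
  where
  open ≡-Reasoning
  a : Mono
  a = pure-u p
  P-x P-y P-z P-v : Series
  P-x = ⟦ Pₑu-x ⟧ᵥ
  P-y = ⟦ Pₑu-y ⟧ᵥ
  P-z = ⟦ Pₑu-z ⟧ᵥ
  P-v = ⟦ Pₑu-v ⟧ᵥ

R-base : Base R
R-base zero    = refl
R-base (suc q) = ι*-cancelˡ (suc q) (ι*-cancelˡ 2 (begin
  ι 2 * (ι (suc q) * R (pure-u (suc q)))   ≡⟨ sym (A⊗θuR-pure-u (suc q)) ⟩
  (⟦ Aₑ ⟧ᵥ ⊗ θ 0F R) (pure-u (suc q))      ≡⟨ coeff (R-euler 0F) (pure-u (suc q)) ⟩
  (R ⊗ ⟦ Pₑ 0F ⟧ᵥ) (pure-u (suc q))        ≡⟨ R⊗Pu-pure-u (suc q) ⟩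
  0ℚ                                       ≡⟨ sym (trans (cong (ι 2 *_) (ℚP.*-zeroʳ (ι (suc q)))) (ℚP.*-zeroʳ (ι 2))) ⟩
  ι 2 * (ι (suc q) * 0ℚ)                   ∎))
  where open ≡-Reasoning

R-recurrences : Recurrences R
R-recurrences = record
  { rec-v = R-rec-v ; rec-w = R-rec-w ; rec-x = R-rec-x ; rec-y = R-rec-y ; rec-z = R-rec-z ; base = R-base }

-- The coefficients of the left-hand side

hₙ : ℕ → ℕ → ℕ → ℕ
hₙ M N p = (M C p) ℕ.* (N C p) ℕ.* p !

hₙ-comm : ∀ M N p → hₙ M N p ≡ hₙ N M p
hₙ-comm M N p = cong (ℕ._* p !) (ℕP.*-comm (M C p) (N C p))

hₙ-rec : ∀ M N q → hₙ (suc M) N (suc q) ℕ.+ q ℕ.* hₙ M N q ≡ hₙ M N (suc q) ℕ.+ N ℕ.* hₙ M N q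
hₙ-rec M N q = begin
  hₙ (suc M) N (suc q) ℕ.+ q ℕ.* hₙ M N q
    ≡⟨ cong (λ x → x ℕ.* cN₁ ℕ.* ((1 ℕ.+ q) ℕ.* f) ℕ.+ q ℕ.* (cM₀ ℕ.* cN₀ ℕ.* f)) (pascal M q) ⟩
  (cM₀ ℕ.+ cM₁) ℕ.* cN₁ ℕ.* ((1 ℕ.+ q) ℕ.* f) ℕ.+ q ℕ.* (cM₀ ℕ.* cN₀ ℕ.* f)
    ≡⟨ ℕS.solve 6 (λ cM₀ cM₁ cN₀ cN₁ f q →
         (cM₀ ℕS.:+ cM₁) ℕS.:* cN₁ ℕS.:* ((ℕS.con 1 ℕS.:+ q) ℕS.:* f) ℕS.:+ q ℕS.:* (cM₀ ℕS.:* cN₀ ℕS.:* f)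
         ℕS.:= cM₁ ℕS.:* cN₁ ℕS.:* ((ℕS.con 1 ℕS.:+ q) ℕS.:* f)
               ℕS.:+ cM₀ ℕS.:* f ℕS.:* (cN₁ ℕS.:* (ℕS.con 1 ℕS.:+ q) ℕS.:+ q ℕS.:* cN₀))
         refl cM₀ cM₁ cN₀ cN₁ f q ⟩
  cM₁ ℕ.* cN₁ ℕ.* ((1 ℕ.+ q) ℕ.* f) ℕ.+ cM₀ ℕ.* f ℕ.* (cN₁ ℕ.* (1 ℕ.+ q) ℕ.+ q ℕ.* cN₀)
    ≡⟨ cong (λ x → cM₁ ℕ.* cN₁ ℕ.* ((1 ℕ.+ q) ℕ.* f) ℕ.+ cM₀ ℕ.* f ℕ.* x) (C-absorption N q) ⟩
  cM₁ ℕ.* cN₁ ℕ.* ((1 ℕ.+ q) ℕ.* f) ℕ.+ cM₀ ℕ.* f ℕ.* (N ℕ.* cN₀)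
    ≡⟨ ℕS.solve 7 (λ cM₀ cM₁ cN₀ cN₁ g f N → cM₁ ℕS.:* cN₁ ℕS.:* g ℕS.:+ cM₀ ℕS.:* f ℕS.:* (N ℕS.:* cN₀)
                                          ℕS.:= cM₁ ℕS.:* cN₁ ℕS.:* g ℕS.:+ N ℕS.:* (cM₀ ℕS.:* cN₀ ℕS.:* f))
         refl cM₀ cM₁ cN₀ cN₁ ((1 ℕ.+ q) ℕ.* f) f N ⟩
  hₙ M N (suc q) ℕ.+ N ℕ.* hₙ M N q ∎
  where
  open ≡-Reasoning
  cM₀ cM₁ cN₀ cN₁ f : ℕ
  cM₀ = M C q
  cM₁ = M C suc q
  cN₀ = N C q
  cN₁ = N C suc q
  f = q !

Hcoeff≡ι-hₙ : ∀ M N p → Hcoeff M N p ≡ ι (hₙ M N p)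
Hcoeff≡ι-hₙ M N p with p ≤ᵇ (M ℕ.⊓ N) in p≤ᵇM⊓N
... | true  = refl
... | false = sym (cong ι (hₙ≡0 (p ℕ.≤? M) (p ℕ.≤? N)))
  where
  hₙ≡0 : Dec (p ≤ M) → Dec (p ≤ N) → hₙ M N p ≡ 0
  hₙ≡0 (no p≰M) _         = cong (λ x → x ℕ.* (N C p) ℕ.* p !) (k>n⇒nCk≡0 (ℕP.≰⇒> p≰M))
  hₙ≡0 (yes _)  (no p≰N)  = trans (cong (λ x → (M C p) ℕ.* x ℕ.* p !) (k>n⇒nCk≡0 (ℕP.≰⇒> p≰N)))
                                  (cong (ℕ._* p !) (ℕP.*-zeroʳ (M C p)))
  hₙ≡0 (yes p≤M) (yes p≤N) = ⊥-elim (subst T p≤ᵇM⊓N (ℕP.≤⇒≤ᵇ (ℕP.⊓-glb p≤M p≤N)))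

factorials : ℕ → ℕ → ℕ → ℕ → ℕ → ℕ
factorials i j k l m = i ! ℕ.* j ! ℕ.* k ! ℕ.* l ! ℕ.* m !

factorials≢0 : ∀ i j k l m → ℕ.NonZero (factorials i j k l m)
factorials≢0 i j k l m = ℕP.m*n≢0 _ _
  {{ℕP.m*n≢0 _ _ {{ℕP.m*n≢0 _ _ {{ℕP.m*n≢0 _ _ {{i ℕP.!≢0}} {{j ℕP.!≢0}}}} {{k ℕP.!≢0}}}} {{l ℕP.!≢0}}}}
  {{m ℕP.!≢0}}

1/factorials : ℕ → ℕ → ℕ → ℕ → ℕ → ℚ
1/factorials i j k l m = (ℤ.+ 1 / factorials i j k l m) {{factorials≢0 i j k l m}}

LHS-mono : ∀ p i j k l m →
  LHS (mono p i j k l m) ≡ ι (hₙ (weight i k m) (weight j l m) p) * 1/factorials i j k l m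
LHS-mono p i j k l m = cong (_* 1/factorials i j k l m) (Hcoeff≡ι-hₙ (weight i k m) (weight j l m) p)

private
  1/factorials-step : ∀ n i j k l m i′ j′ k′ l′ m′ →
    factorials i′ j′ k′ l′ m′ ≡ suc n ℕ.* factorials i j k l m →
    ι (suc n) * 1/factorials i′ j′ k′ l′ m′ ≡ 1/factorials i j k l m
  1/factorials-step n i j k l m i′ j′ k′ l′ m′ =
    n*[1/d′]≡1/d (suc n) (factorials i j k l m) (factorials i′ j′ k′ l′ m′)
      {{factorials≢0 i j k l m}} {{factorials≢0 i′ j′ k′ l′ m′}}

1/factorials-i : ∀ i j k l m → ι (suc i) * 1/factorials (suc i) j k l m ≡ 1/factorials i j k l m
1/factorials-i i j k l m = 1/factorials-step i i j k l m (suc i) j k l m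
  (ℕS.solve 6 (λ i a b c d e → (ℕS.con 1 ℕS.:+ i) ℕS.:* a ℕS.:* b ℕS.:* c ℕS.:* d ℕS.:* e
                          ℕS.:= (ℕS.con 1 ℕS.:+ i) ℕS.:* (a ℕS.:* b ℕS.:* c ℕS.:* d ℕS.:* e))
              refl i (i !) (j !) (k !) (l !) (m !))

1/factorials-j : ∀ i j k l m → ι (suc j) * 1/factorials i (suc j) k l m ≡ 1/factorials i j k l m
1/factorials-j i j k l m = 1/factorials-step j i j k l m i (suc j) k l m
  (ℕS.solve 6 (λ j a b c d e → a ℕS.:* ((ℕS.con 1 ℕS.:+ j) ℕS.:* b) ℕS.:* c ℕS.:* d ℕS.:* e
                          ℕS.:= (ℕS.con 1 ℕS.:+ j) ℕS.:* (a ℕS.:* b ℕS.:* c ℕS.:* d ℕS.:* e))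
              refl j (i !) (j !) (k !) (l !) (m !))

1/factorials-k : ∀ i j k l m → ι (suc k) * 1/factorials i j (suc k) l m ≡ 1/factorials i j k l m
1/factorials-k i j k l m = 1/factorials-step k i j k l m i j (suc k) l m
  (ℕS.solve 6 (λ k a b c d e → a ℕS.:* b ℕS.:* ((ℕS.con 1 ℕS.:+ k) ℕS.:* c) ℕS.:* d ℕS.:* e
                          ℕS.:= (ℕS.con 1 ℕS.:+ k) ℕS.:* (a ℕS.:* b ℕS.:* c ℕS.:* d ℕS.:* e))
              refl k (i !) (j !) (k !) (l !) (m !))

1/factorials-l : ∀ i j k l m → ι (suc l) * 1/factorials i j k (suc l) m ≡ 1/factorials i j k l m
1/factorials-l i j k l m = 1/factorials-step l i j k l m i j k (suc l) m
  (ℕS.solve 6 (λ l a b c d e → a ℕS.:* b ℕS.:* c ℕS.:* ((ℕS.con 1 ℕS.:+ l) ℕS.:* d) ℕS.:* e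
                          ℕS.:= (ℕS.con 1 ℕS.:+ l) ℕS.:* (a ℕS.:* b ℕS.:* c ℕS.:* d ℕS.:* e))
              refl l (i !) (j !) (k !) (l !) (m !))

1/factorials-m : ∀ i j k l m → ι (suc m) * 1/factorials i j k l (suc m) ≡ 1/factorials i j k l m
1/factorials-m i j k l m = 1/factorials-step m i j k l m i j k l (suc m)
  (ℕS.solve 6 (λ m a b c d e → a ℕS.:* b ℕS.:* c ℕS.:* d ℕS.:* ((ℕS.con 1 ℕS.:+ m) ℕS.:* e)
                          ℕS.:= (ℕS.con 1 ℕS.:+ m) ℕS.:* (a ℕS.:* b ℕS.:* c ℕS.:* d ℕS.:* e))
              refl m (i !) (j !) (k !) (l !) (m !))

ι-scaled-identity : ∀ A B C N q x →
  A ℕ.+ q ℕ.* C ≡ B ℕ.+ N ℕ.* C → ι A * x ≡ ι B * x + (ι N - ι q) * (ι C * x)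
ι-scaled-identity A B C N q x A+qC≡B+NC = begin
  ι A * x
    ≡⟨ ℚS.solve 4 (λ a q c x → a ℚS.:* x ℚS.:= (a ℚS.:+ q ℚS.:* c) ℚS.:* x ℚS.:+ ℚS.:- (q ℚS.:* (c ℚS.:* x)))
                  refl (ι A) (ι q) (ι C) x ⟩
  (ι A + ι q * ι C) * x - ι q * (ι C * x)
    ≡⟨ cong (λ t → t * x - ι q * (ι C * x)) in-ℚ ⟩
  (ι B + ι N * ι C) * x - ι q * (ι C * x)
    ≡⟨ ℚS.solve 5 (λ b n c q x → (b ℚS.:+ n ℚS.:* c) ℚS.:* x ℚS.:+ ℚS.:- (q ℚS.:* (c ℚS.:* x))
                                 ℚS.:= b ℚS.:* x ℚS.:+ (n ℚS.:+ ℚS.:- q) ℚS.:* (c ℚS.:* x))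
                  refl (ι B) (ι N) (ι C) (ι q) x ⟩
  ι B * x + (ι N - ι q) * (ι C * x) ∎
  where
  open ≡-Reasoning
  in-ℚ : ι A + ι q * ι C ≡ ι B + ι N * ι C
  in-ℚ = begin
    ι A + ι q * ι C           ≡⟨ cong (ι A +_) (sym (ι-* q C)) ⟩
    ι A + ι (q ℕ.* C)         ≡⟨ sym (ι-+ A _) ⟩
    ι (A ℕ.+ q ℕ.* C)         ≡⟨ cong ι A+qC≡B+NC ⟩
    ι (B ℕ.+ N ℕ.* C)         ≡⟨ ι-+ B _ ⟩
    ι B + ι (N ℕ.* C)         ≡⟨ cong (ι B +_) (ι-* N C) ⟩
    ι B + ι N * ι C           ∎

LHS-rec-v : RecV LHS
LHS-rec-v p i j k l m = begin
  ι (suc i) * LHS (mono p (suc i) j k l m)                 ≡⟨ cong (ι (suc i) *_) (LHS-mono p (suc i) j k l m) ⟩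
  ι (suc i) * (ι (hₙ (suc M) N p) * 1/factorials (suc i) j k l m)
    ≡⟨ x∙yz≈y∙xz (ι (suc i)) (ι (hₙ (suc M) N p)) (1/factorials (suc i) j k l m) ⟩
  ι (hₙ (suc M) N p) * (ι (suc i) * 1/factorials (suc i) j k l m)
    ≡⟨ cong (ι (hₙ (suc M) N p) *_) (1/factorials-i i j k l m) ⟩
  ι (hₙ (suc M) N p) * f                                   ≡⟨ by-p p ⟩
  LHS (mono p i j k l m) + uCorrection LHS N p i j k l m   ∎
  where
  open ≡-Reasoning
  M N : ℕ
  M = weight i k m
  N = weight j l m
  f : ℚ
  f = 1/factorials i j k l m
  by-p : ∀ p → ι (hₙ (suc M) N p) * f ≡ LHS (mono p i j k l m) + uCorrection LHS N p i j k l m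
  by-p zero    = sym (trans (ℚP.+-identityʳ _) (LHS-mono 0 i j k l m))
  by-p (suc q) = trans (ι-scaled-identity _ _ _ N q f (hₙ-rec M N q))
    (sym (cong₂ (λ s t → s + (ι N - ι q) * t) (LHS-mono (suc q) i j k l m) (LHS-mono q i j k l m)))

LHS-rec-w : RecW LHS
LHS-rec-w p i j k l m = begin
  ι (suc j) * LHS (mono p i (suc j) k l m)                 ≡⟨ cong (ι (suc j) *_) (LHS-mono p i (suc j) k l m) ⟩
  ι (suc j) * (ι (hₙ M (suc N) p) * 1/factorials i (suc j) k l m)
    ≡⟨ x∙yz≈y∙xz (ι (suc j)) (ι (hₙ M (suc N) p)) (1/factorials i (suc j) k l m) ⟩
  ι (hₙ M (suc N) p) * (ι (suc j) * 1/factorials i (suc j) k l m)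
    ≡⟨ cong (ι (hₙ M (suc N) p) *_) (1/factorials-j i j k l m) ⟩
  ι (hₙ M (suc N) p) * f                                   ≡⟨ by-p p ⟩
  LHS (mono p i j k l m) + uCorrection LHS M p i j k l m   ∎
  where
  open ≡-Reasoning
  M N : ℕ
  M = weight i k m
  N = weight j l m
  f : ℚ
  f = 1/factorials i j k l m
  hₙ-rec′ : ∀ q → hₙ M (suc N) (suc q) ℕ.+ q ℕ.* hₙ M N q ≡ hₙ M N (suc q) ℕ.+ M ℕ.* hₙ M N q
  hₙ-rec′ q = trans (cong₂ (λ s t → s ℕ.+ q ℕ.* t) (hₙ-comm M (suc N) (suc q)) (hₙ-comm M N q))
    (trans (hₙ-rec N M q) (cong₂ (λ s t → s ℕ.+ M ℕ.* t) (hₙ-comm N M (suc q)) (hₙ-comm N M q)))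
  by-p : ∀ p → ι (hₙ M (suc N) p) * f ≡ LHS (mono p i j k l m) + uCorrection LHS M p i j k l m
  by-p zero    = sym (trans (ℚP.+-identityʳ _) (LHS-mono 0 i j k l m))
  by-p (suc q) = trans (ι-scaled-identity _ _ _ M q f (hₙ-rec′ q))
    (sym (cong₂ (λ s t → s + (ι M - ι q) * t) (LHS-mono (suc q) i j k l m) (LHS-mono q i j k l m)))

ι[ab]*[h*x]≡h*[b*[a*x]] : ∀ a b h x → ι (a ℕ.* b) * (h * x) ≡ h * (ι b * (ι a * x))
ι[ab]*[h*x]≡h*[b*[a*x]] a b h x = trans (cong (_* (h * x)) (ι-* a b))
  (ℚS.solve 4 (λ a b h x → (a ℚS.:* b) ℚS.:* (h ℚS.:* x) ℚS.:= h ℚS.:* (b ℚS.:* (a ℚS.:* x)))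
              refl (ι a) (ι b) h x)

LHS-rec-x : RecX LHS
LHS-rec-x p i j k l m = begin
  ι (suc k) * LHS (mono p i j (suc k) l m)           ≡⟨ cong (ι (suc k) *_) (LHS-mono p i j (suc k) l m) ⟩
  ι (suc k) * (ι h′ * 1/factorials i j (suc k) l m)   ≡⟨ x∙yz≈y∙xz (ι (suc k)) (ι h′) (1/factorials i j (suc k) l m) ⟩
  ι h′ * (ι (suc k) * 1/factorials i j (suc k) l m)   ≡⟨ cong₂ (λ w t → ι (hₙ w N p) * t) weight≡ (1/factorials-k i j k l m) ⟩
  ι h * 1/factorials i j k l m
    ≡⟨ cong (ι h *_) (sym (trans (cong (ι (suc i) *_) (1/factorials-i (suc i) j k l m)) (1/factorials-i i j k l m))) ⟩
  ι h * (ι (suc i) * (ι (2 ℕ.+ i) * f))               ≡⟨ sym (ι[ab]*[h*x]≡h*[b*[a*x]] (2 ℕ.+ i) (suc i) (ι h) f) ⟩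
  ι ((2 ℕ.+ i) ℕ.* suc i) * (ι h * f)                 ≡⟨ cong (ι ((2 ℕ.+ i) ℕ.* suc i) *_) (sym (LHS-mono p (2 ℕ.+ i) j k l m)) ⟩
  ι ((2 ℕ.+ i) ℕ.* suc i) * LHS (mono p (2 ℕ.+ i) j k l m) ∎
  where
  open ≡-Reasoning
  N h h′ : ℕ
  N  = weight j l m
  h  = hₙ (weight (2 ℕ.+ i) k m) N p
  h′ = hₙ (weight i (suc k) m) N p
  f : ℚ
  f = 1/factorials (2 ℕ.+ i) j k l m
  weight≡ : weight i (suc k) m ≡ weight (2 ℕ.+ i) k m
  weight≡ = ℕS.solve 3 (λ i k m → i ℕS.:+ ℕS.con 2 ℕS.:* (ℕS.con 1 ℕS.:+ k) ℕS.:+ m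
                                  ℕS.:= ℕS.con 2 ℕS.:+ i ℕS.:+ ℕS.con 2 ℕS.:* k ℕS.:+ m) refl i k m

LHS-rec-y : RecY LHS
LHS-rec-y p i j k l m = begin
  ι (suc l) * LHS (mono p i j k (suc l) m)           ≡⟨ cong (ι (suc l) *_) (LHS-mono p i j k (suc l) m) ⟩
  ι (suc l) * (ι h′ * 1/factorials i j k (suc l) m)   ≡⟨ x∙yz≈y∙xz (ι (suc l)) (ι h′) (1/factorials i j k (suc l) m) ⟩
  ι h′ * (ι (suc l) * 1/factorials i j k (suc l) m)   ≡⟨ cong₂ (λ w t → ι (hₙ M w p) * t) weight≡ (1/factorials-l i j k l m) ⟩
  ι h * 1/factorials i j k l m
    ≡⟨ cong (ι h *_) (sym (trans (cong (ι (suc j) *_) (1/factorials-j i (suc j) k l m)) (1/factorials-j i j k l m))) ⟩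
  ι h * (ι (suc j) * (ι (2 ℕ.+ j) * f))               ≡⟨ sym (ι[ab]*[h*x]≡h*[b*[a*x]] (2 ℕ.+ j) (suc j) (ι h) f) ⟩
  ι ((2 ℕ.+ j) ℕ.* suc j) * (ι h * f)                 ≡⟨ cong (ι ((2 ℕ.+ j) ℕ.* suc j) *_) (sym (LHS-mono p i (2 ℕ.+ j) k l m)) ⟩
  ι ((2 ℕ.+ j) ℕ.* suc j) * LHS (mono p i (2 ℕ.+ j) k l m) ∎
  where
  open ≡-Reasoning
  M h h′ : ℕ
  M  = weight i k m
  h  = hₙ M (weight (2 ℕ.+ j) l m) p
  h′ = hₙ M (weight j (suc l) m) p
  f : ℚ
  f = 1/factorials i (2 ℕ.+ j) k l m
  weight≡ : weight j (suc l) m ≡ weight (2 ℕ.+ j) l m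
  weight≡ = ℕS.solve 3 (λ j l m → j ℕS.:+ ℕS.con 2 ℕS.:* (ℕS.con 1 ℕS.:+ l) ℕS.:+ m
                                  ℕS.:= ℕS.con 2 ℕS.:+ j ℕS.:+ ℕS.con 2 ℕS.:* l ℕS.:+ m) refl j l m

LHS-rec-z : RecZ LHS
LHS-rec-z p i j k l m = begin
  ι (suc m) * LHS (mono p i j k l (suc m))
    ≡⟨ cong (ι (suc m) *_) (trans (LHS-mono p i j k l (suc m)) (cong₂ (λ s t → ι (hₙ s t p) * 1/factorials i j k l (suc m))
                                                                        (ℕP.+-suc (i ℕ.+ 2 ℕ.* k) m) (ℕP.+-suc (j ℕ.+ 2 ℕ.* l) m))) ⟩
  ι (suc m) * (ι h * 1/factorials i j k l (suc m))
    ≡⟨ x∙yz≈y∙xz (ι (suc m)) (ι h) (1/factorials i j k l (suc m)) ⟩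
  ι h * (ι (suc m) * 1/factorials i j k l (suc m))
    ≡⟨ cong (ι h *_) (trans (1/factorials-m i j k l m)
         (sym (trans (cong (ι (suc i) *_) (1/factorials-j (suc i) j k l m)) (1/factorials-i i j k l m)))) ⟩
  ι h * (ι (suc i) * (ι (suc j) * f))
    ≡⟨ ℚS.solve 4 (λ h a b x → h ℚS.:* (a ℚS.:* (b ℚS.:* x)) ℚS.:= a ℚS.:* (b ℚS.:* (h ℚS.:* x)))
                  refl (ι h) (ι (suc i)) (ι (suc j)) f ⟩
  ι (suc i) * (ι (suc j) * (ι h * f))
    ≡⟨ cong (λ t → ι (suc i) * (ι (suc j) * t)) (sym (LHS-mono p (suc i) (suc j) k l m)) ⟩
  ι (suc i) * (ι (suc j) * LHS (mono p (suc i) (suc j) k l m)) ∎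
  where
  open ≡-Reasoning
  h : ℕ
  h = hₙ (suc (weight i k m)) (suc (weight j l m)) p
  f : ℚ
  f = 1/factorials (suc i) (suc j) k l m

LHS-base : Base LHS
LHS-base zero    = refl
LHS-base (suc q) = refl

LHS-recurrences : Recurrences LHS
LHS-recurrences = record
  { rec-v = LHS-rec-v ; rec-w = LHS-rec-w ; rec-x = LHS-rec-x ; rec-y = LHS-rec-y ; rec-z = LHS-rec-z
  ; base = LHS-base }

-- Uniqueness of the solution of the recurrences

-- Each recurrence expresses F at a monomial through F at monomials of one smaller size, of any u-degree.
size : ℕ → ℕ → ℕ → ℕ → ℕ → ℕ
size i j k l m = i ℕ.+ j ℕ.+ 3 ℕ.* (k ℕ.+ l ℕ.+ m)

size-z : ∀ i j k l m → suc (size (suc i) (suc j) k l m) ≡ size i j k l (suc m)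
size-z = ℕS.solve 5 (λ i j k l m →
  ℕS.con 1 ℕS.:+ ((ℕS.con 1 ℕS.:+ i) ℕS.:+ (ℕS.con 1 ℕS.:+ j) ℕS.:+ ℕS.con 3 ℕS.:* (k ℕS.:+ l ℕS.:+ m))
  ℕS.:= i ℕS.:+ j ℕS.:+ ℕS.con 3 ℕS.:* (k ℕS.:+ l ℕS.:+ (ℕS.con 1 ℕS.:+ m))) refl

size-x : ∀ i j k l → suc (size (2 ℕ.+ i) j k l 0) ≡ size i j (suc k) l 0
size-x = ℕS.solve 4 (λ i j k l →
  ℕS.con 1 ℕS.:+ ((ℕS.con 2 ℕS.:+ i) ℕS.:+ j ℕS.:+ ℕS.con 3 ℕS.:* (k ℕS.:+ l ℕS.:+ ℕS.con 0))
  ℕS.:= i ℕS.:+ j ℕS.:+ ℕS.con 3 ℕS.:* ((ℕS.con 1 ℕS.:+ k) ℕS.:+ l ℕS.:+ ℕS.con 0)) refl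

size-y : ∀ i j l → suc (size i (2 ℕ.+ j) 0 l 0) ≡ size i j 0 (suc l) 0
size-y = ℕS.solve 3 (λ i j l →
  ℕS.con 1 ℕS.:+ (i ℕS.:+ (ℕS.con 2 ℕS.:+ j) ℕS.:+ ℕS.con 3 ℕS.:* (ℕS.con 0 ℕS.:+ l ℕS.:+ ℕS.con 0))
  ℕS.:= i ℕS.:+ j ℕS.:+ ℕS.con 3 ℕS.:* (ℕS.con 0 ℕS.:+ (ℕS.con 1 ℕS.:+ l) ℕS.:+ ℕS.con 0)) refl

uCorrection-cong : ∀ {F G : Mono → ℚ} n i j k l m → (∀ q → F (mono q i j k l m) ≡ G (mono q i j k l m)) →
  ∀ p → uCorrection F n p i j k l m ≡ uCorrection G n p i j k l m
uCorrection-cong n i j k l m F≡G zero    = refl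
uCorrection-cong n i j k l m F≡G (suc q) = cong ((ι n - ι q) *_) (F≡G q)

module _ {F G : Mono → ℚ} (recF : Recurrences F) (recG : Recurrences G) where
  private
    module F = Recurrences recF
    module G = Recurrences recG

    Agree : ℕ → Set
    Agree n = ∀ p i j k l m → size i j k l m ≡ n → F (mono p i j k l m) ≡ G (mono p i j k l m)

    cancel : ∀ n {x y x′ y′} → ι (suc n) * x ≡ x′ → ι (suc n) * y ≡ y′ → x′ ≡ y′ → x ≡ y
    cancel n x≡x′ y≡y′ x′≡y′ = ι*-cancelˡ (suc n) (trans x≡x′ (trans x′≡y′ (sym y≡y′)))

    smaller : ∀ {s n t} → suc s ≡ t → t ≡ n → s < n
    smaller {s} refl refl = ℕP.n<1+n s

    agree : ∀ n → (∀ {n′} → n′ < n → Agree n′) → Agree n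
    agree n ih p i j k l (suc m) size≡n = cancel m (F.rec-z p i j k l m) (G.rec-z p i j k l m)
      (cong (λ t → ι (suc i) * (ι (suc j) * t)) (ih (smaller (size-z i j k l m) size≡n) p (suc i) (suc j) k l m refl))
    agree n ih p i j (suc k) l zero size≡n = cancel k (F.rec-x p i j k l 0) (G.rec-x p i j k l 0)
      (cong (ι ((2 ℕ.+ i) ℕ.* suc i) *_) (ih (smaller (size-x i j k l) size≡n) p (2 ℕ.+ i) j k l 0 refl))
    agree n ih p i j zero (suc l) zero size≡n = cancel l (F.rec-y p i j 0 l 0) (G.rec-y p i j 0 l 0)
      (cong (ι ((2 ℕ.+ j) ℕ.* suc j) *_) (ih (smaller (size-y i j l) size≡n) p i (2 ℕ.+ j) 0 l 0 refl))
    agree n ih p (suc i) j zero zero zero size≡n = cancel i (F.rec-v p i j 0 0 0) (G.rec-v p i j 0 0 0)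
      (cong₂ _+_ (below p) (uCorrection-cong (weight j 0 0) i j 0 0 0 below p))
      where
      below : ∀ q → F (mono q i j 0 0 0) ≡ G (mono q i j 0 0 0)
      below q = ih (smaller refl size≡n) q i j 0 0 0 refl
    agree n ih p zero (suc j) zero zero zero size≡n = cancel j (F.rec-w p 0 j 0 0 0) (G.rec-w p 0 j 0 0 0)
      (cong₂ _+_ (below p) (uCorrection-cong (weight 0 0 0) 0 j 0 0 0 below p))
      where
      below : ∀ q → F (mono q 0 j 0 0 0) ≡ G (mono q 0 j 0 0 0)
      below q = ih (smaller refl size≡n) q 0 j 0 0 0 refl
    agree n ih p zero zero zero zero zero _ = trans (F.base p) (sym (G.base p))

  recurrences-unique : ∀ p i j k l m → F (mono p i j k l m) ≡ G (mono p i j k l m)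
  recurrences-unique p i j k l m = <-rec Agree agree (size i j k l m) p i j k l m refl

theorem5p5 : (a : Mono) → LHS a ≡ RHS a
theorem5p5 (p ∷ i ∷ j ∷ k ∷ l ∷ m ∷ []) = recurrences-unique LHS-recurrences R-recurrences p i j k l m
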